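{- Let $t\ge 3$, $k_1>k_2\geq k_3\ge\cdots\geq k_t\ge 2$ and $k_1+k_3\leq n<k_1+k_2$. Then $$g([2,k_2+1])<\max\{g(\{1,n-k_2+2,\dots,n\}),\ g([2,k_2]\cup\{n\})\}$$ and $$g([k_t,k_t+k_2-1])<\max\{g(\{k_t-1,n-k_2+2,\dots,n\}),\ g([k_t,k_t+k_2-2]\cup\{n\})\}.$$
   Context: Lexicographic order: $A\prec B$ if $A\supseteq B$ or $\min(A\setminus B)<\min(B\setminus A)$. $\mathcal{L}(R,k)=\{F\in\binom{[n]}{k}:F\prec R\}$. For $F\subseteq[n]$, $\ell(F)=\max\{x:[n-x+1,n]\subseteq F\}$ if $n\in F$ and $0$ otherwise; $F^{\mathrm t}=[n-\ell(F)+1,n]$ (empty if $\ell(F)=0$). Partner: $H$ is the partner of nonempty $F$ if $F\cap H=\{q\}$ and $F\cup H=[q]$ for some $q$. $k$-partner of $F$ ($|F|=f$, $k\le n-f$), with $H$ the partner of $F$, $h=|H|$: $H$ if $k=h$; $H\cup\{n-k+h+1,\dots,n\}$ if $k>h$; the lexicographically last $k$-set $K\prec H$ if $k<h$. For $h_1\le h_2$: an $h_2$-set $H_2$ is the $h_2$-parity of an $h_1$-set $H_1$ if $H_1\setminus H_1^{\mathrm t}=H_2\setminus H_2^{\mathrm t}$ and $\ell(H_2)-\ell(H_1)=h_2-h_1$. For a $k_2$-subset $G_2$ of $[n]$ having a $k_1$-parity $G_1$, with $T_i$ the $k_i$-partner of $G_2$ for $i\in[3,t]$, define $g(G_2)=|\mathcal{L}(G_1,k_1)|+|\mathcal{L}(G_2,k_2)|+\sum_{i=3}^t|\mathcal{L}(T_i,k_i)|$.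 -}

module Defs where

-- Finite subsets of [n] = {1,...,n} are represented by lists of naturals.
-- All set-theoretic operations below (membership, difference, lex order,
-- minima, tails) only depend on the underlying set of elements, not on the
-- order of the list.  k-subsets of [n] are enumerated (each exactly once, as
-- strictly increasing lists) by  kSubsets n k.

open import Data.Bool using (Bool; true; false; not; _∧_; _∨_; if_then_else_)
open import Data.Nat using (ℕ; zero; suc; _+_; _∸_; _≤_; _<ᵇ_; _≡ᵇ_; _≤ᵇ_; _⊔_)
open import Data.List using (List; []; _∷_; _++_; map; upTo; filterᵇ; length; foldl)
open import Data.Bool.ListAction using (any; all)
open import Data.Nat.ListAction using (sum)
open import Data.List.Membership.Propositional using (_∈_)
open import Data.Maybe using (Maybe; just; nothing)
open import Data.Product using (_×_)
open import Relation.Binary.PropositionalEquality using (_≡_)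

-- integer interval [a,b] (empty if a > b)
range : ℕ → ℕ → List ℕ
range a b = map (a +_) (upTo (suc b ∸ a))

memᵇ : ℕ → List ℕ → Bool
memᵇ x A = any (λ y → x ≡ᵇ y) A

diff : List ℕ → List ℕ → List ℕ
diff A B = filterᵇ (λ x → not (memᵇ x B)) A

subsetᵇ : List ℕ → List ℕ → Bool
subsetᵇ A B = all (λ x → memᵇ x B) A

minL : List ℕ → Maybe ℕ
minL [] = nothing
minL (x ∷ xs) with minL xs
... | nothing = just x
... | just m  = just (if x <ᵇ m then x else m)

lexᵇ : List ℕ → List ℕ → Bool
lexᵇ A B with subsetᵇ B A | minL (diff A B) | minL (diff B A)
... | true  | _      | _      = true
... | false | just a | just b = a <ᵇ b
... | false | _      | _      = false

choose : ℕ → List ℕ → List (List ℕ)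
choose zero    _        = [] ∷ []
choose (suc k) []       = []
choose (suc k) (x ∷ xs) = map (x ∷_) (choose k xs) ++ choose (suc k) xs

kSubsets : ℕ → ℕ → List (List ℕ)
kSubsets n k = choose k (range 1 n)

Lcount : ℕ → ℕ → List ℕ → ℕ
Lcount n k R = length (filterᵇ (λ F → lexᵇ F R) (kSubsets n k))

-- ℓ(F) = max{x : [n-x+1,n] ⊆ F} if n ∈ F, 0 otherwise
ellFrom : List ℕ → ℕ → ℕ → ℕ   -- fuel, current top element m
ellFrom F zero    _       = 0
ellFrom F (suc f) zero    = 0
ellFrom F (suc f) (suc m) = if memᵇ (suc m) F then suc (ellFrom F f m) else 0

ell : ℕ → List ℕ → ℕ
ell n F = ellFrom F n n

tailSet : ℕ → List ℕ → List ℕ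
tailSet n F = range (suc (n ∸ ell n F)) n

nonTail : ℕ → List ℕ → List ℕ
nonTail n F = diff F (tailSet n F)

-- maximum of a finite set (0 for the empty set)
maxL : List ℕ → ℕ
maxL = foldl _⊔_ 0

-- The partner H of a nonempty F ⊆ [n]: F ∩ H = {q}, F ∪ H = [q].
-- These conditions force q = max F and H = ([q] ∖ F) ∪ {q}.
partner : List ℕ → List ℕ
partner F = filterᵇ (λ x → not (memᵇ x F) ∨ (x ≡ᵇ maxL F)) (range 1 (maxL F))

lexLast : List (List ℕ) → List ℕ
lexLast []       = []
lexLast (K ∷ Ks) = foldl (λ acc K' → if lexᵇ acc K' then K' else acc) K Ks

kPartner : ℕ → ℕ → List ℕ → List ℕ
kPartner n k F with partner F
... | H with k ≡ᵇ length H | length H <ᵇ k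
...   | true  | _     = H
...   | false | true  = H ++ range (suc (n ∸ k + length H)) n
...   | false | false = lexLast (filterᵇ (λ K → lexᵇ K H) (kSubsets n k))

SameSet : List ℕ → List ℕ → Set
SameSet A B = ∀ x → (x ∈ A → x ∈ B) × (x ∈ B → x ∈ A)

IsParity : ℕ → ℕ → ℕ → List ℕ → List ℕ → Set
IsParity n h₁ h₂ H₁ H₂ =
  h₁ ≤ h₂ × H₂ ∈ kSubsets n h₂ × SameSet (nonTail n H₁) (nonTail n H₂)
  × ell n H₂ ≡ ell n H₁ + (h₂ ∸ h₁)

-- g(G₂) for the k₂-set G₂ whose k₁-parity is G₁; sequence k₁,...,k_t given by k
g : ℕ → ℕ → (ℕ → ℕ) → List ℕ → List ℕ → ℕ
g n t k G₁ G₂ = Lcount n (k 1) G₁ + Lcount n (k 2) G₂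
  + sum (map (λ i → Lcount n (k i) (kPartner n (k i) G₂)) (range 3 t))

{-# OPTIONS --safe #-}
-- Every count |L(R,k)| in g is evaluated exactly. Comparing a k-set with R lexicographically
-- is a scan of [1,n] for the first point where the two differ, so |L(R,k)| is a function of the
-- characteristic vector of R (lexRank); for all sets occurring here that vector consists of at
-- most five constant runs, and the counts become binomial coefficients.
--
-- Write G_D = [s, s+k-1], G_E = {s-1} ∪ [n-k+2, n] and G_F = [s, s+k-2] ∪ {n}, where s = 2 or
-- s = k_t, k = k₂, j = k₁ - k, M = n - (s-1) - k, w = M - j and N = n - (s-1). The partner sizes
-- are kᵢ = s - 1 + bᵢ with 1 ≤ bᵢ ≤ w, and with c = C(n,k₁) + C(n,k) - C(N,k₁) - C(N,k)
--   g(G_D) = c + C(M,j) + 1 + Σᵢ (C(N,bᵢ) - C(M,bᵢ)),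
--   g(G_E) = c + Σᵢ C(N,bᵢ),
--   g(G_F) = c + C(M,j) + C(M,j+1) + M + 1 + Σᵢ (C(N,bᵢ) - C(M+1,bᵢ)).
-- If g(G_D) were maximal, then Σᵢ C(M,bᵢ) ≤ C(M,j) + 1 and C(M,j+1) + M ≤ Σᵢ C(M,bᵢ-1). But
-- (j+1)·C(M,b-1) ≤ w·C(M,b) for b ≤ w and (j+1)·C(M,j+1) = w·C(M,j), so together they give
-- (j+1)·M ≤ w < M.
module Submission where

open import Defs
open import Data.Bool using (Bool; true; false; not; _∧_; _∨_; if_then_else_)
open import Data.Bool.Properties using (∧-zeroʳ; ∧-identityʳ; T-≡; T?; ∨-zeroʳ; ∨-identityʳ)
open import Data.Empty using (⊥; ⊥-elim)
open import Data.List using (List; []; _∷_; _++_; filterᵇ; map; length; foldl; applyUpTo; replicate)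
open import Data.List.Membership.Propositional using (_∈_)
open import Data.List.Membership.Propositional.Properties using (∈-++⁻; ∈-map⁻; ∈-filter⁺; ∈-filter⁻)
open import Data.List.Properties using (length-++; length-map; filter-++; filter-all; filter-none;
  map-applyUpTo; length-replicate; map-++; ++-identityʳ)
open import Data.List.Relation.Unary.Any using (here; there)
open import Data.Maybe using (Maybe; just; nothing)
open import Data.Nat using (ℕ; zero; suc; _≤_; _<_; _<ᵇ_; _≡ᵇ_; _+_; z≤n; s≤s; z<s; _∸_; _≤?_; _⊔_; _*_;
  _<?_; _≤′_; ≤′-refl; ≤′-step)
open import Data.Nat.Combinatorics using (_C_; nCn≡1; nC1≡n) renaming (nCk+nC[k+1]≡[n+1]C[k+1] to pascal)
open import Data.Nat.ListAction using (sum)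
open import Data.Nat.Properties
open import Data.Nat.Solver using (module +-*-Solver)
open import Data.Product using (_×_; _,_; proj₁; proj₂; Σ)
open import Data.Sum using (_⊎_; inj₁; inj₂)
open import Data.Unit using (⊤; tt)
open import Function.Bundles using (Equivalence)
open import Relation.Binary.PropositionalEquality
open import Relation.Nullary using (¬_; yes; no)
open Equivalence using (to; from)
import Data.List.Relation.Unary.All as All
open +-*-Solver

≡true⇒≢false : ∀ {b} → b ≡ true → b ≢ false
≡true⇒≢false refl ()

≡true⇔⇒≡ : ∀ {a b : Bool} → (a ≡ true → b ≡ true) → (b ≡ true → a ≡ true) → a ≡ b
≡true⇔⇒≡ {true}  {true}  f g = refl
≡true⇔⇒≡ {true}  {false} f g = sym (f refl)
≡true⇔⇒≡ {false} {true}  f g = g refl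
≡true⇔⇒≡ {false} {false} f g = refl

∨-≡true⁻ : ∀ {a b} → (a ∨ b) ≡ true → a ≡ true ⊎ b ≡ true
∨-≡true⁻ {true}  _ = inj₁ refl
∨-≡true⁻ {false} e = inj₂ e

∧-≡true⁻ : ∀ {a b} → (a ∧ b) ≡ true → a ≡ true × b ≡ true
∧-≡true⁻ {true} {true} _ = refl , refl

≡ᵇ-refl : ∀ x → (x ≡ᵇ x) ≡ true
≡ᵇ-refl x = to T-≡ (≡⇒≡ᵇ x x refl)

≡ᵇ-true⇒≡ : ∀ x y → (x ≡ᵇ y) ≡ true → x ≡ y
≡ᵇ-true⇒≡ x y e = ≡ᵇ⇒≡ x y (from T-≡ e)

≢⇒≡ᵇ-false : ∀ {x y} → x ≢ y → (x ≡ᵇ y) ≡ false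
≢⇒≡ᵇ-false {x} {y} x≢y with x ≡ᵇ y in e
... | true  = ⊥-elim (x≢y (≡ᵇ-true⇒≡ x y e))
... | false = refl

<ᵇ-true⇒< : ∀ x y → (x <ᵇ y) ≡ true → x < y
<ᵇ-true⇒< x y e = <ᵇ⇒< x y (from T-≡ e)

<⇒<ᵇ-true : ∀ {x y} → x < y → (x <ᵇ y) ≡ true
<⇒<ᵇ-true x<y = to T-≡ (<⇒<ᵇ x<y)

<ᵇ-false⇒≥ : ∀ x y → (x <ᵇ y) ≡ false → y ≤ x
<ᵇ-false⇒≥ x y e = ≮⇒≥ λ x<y → ≡true⇒≢false (<⇒<ᵇ-true x<y) e

≥⇒<ᵇ-false : ∀ {x y} → y ≤ x → (x <ᵇ y) ≡ false
≥⇒<ᵇ-false {x} {y} y≤x with x <ᵇ y in e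
... | true  = ⊥-elim (<⇒≱ (<ᵇ-true⇒< x y e) y≤x)
... | false = refl

infix 4 _∈ᵇ_

_∈ᵇ_ : ℕ → List ℕ → Set
y ∈ᵇ L = memᵇ y L ≡ true

memᵇ-++ : ∀ y A B → memᵇ y (A ++ B) ≡ (memᵇ y A ∨ memᵇ y B)
memᵇ-++ y []      B = refl
memᵇ-++ y (x ∷ A) B with y ≡ᵇ x
... | true  = refl
... | false = memᵇ-++ y A B

memᵇ-filterᵇ : ∀ p y A → memᵇ y (filterᵇ p A) ≡ (memᵇ y A ∧ p y)
memᵇ-filterᵇ p y [] = refl
memᵇ-filterᵇ p y (x ∷ A) with p x in px
... | true with y ≡ᵇ x in y≡ᵇx
...   | true rewrite ≡ᵇ-true⇒≡ y x y≡ᵇx | px = refl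
...   | false = memᵇ-filterᵇ p y A
memᵇ-filterᵇ p y (x ∷ A) | false with y ≡ᵇ x in y≡ᵇx
...   | false = memᵇ-filterᵇ p y A
...   | true rewrite ≡ᵇ-true⇒≡ y x y≡ᵇx =
  trans (memᵇ-filterᵇ p x A) (trans (cong (memᵇ x A ∧_) px) (trans (∧-zeroʳ (memᵇ x A)) (sym px)))

∈ᵇ-here : ∀ x xs → x ∈ᵇ x ∷ xs
∈ᵇ-here x xs rewrite ≡ᵇ-refl x = refl

∈ᵇ-there : ∀ x y xs → y ∈ᵇ xs → y ∈ᵇ x ∷ xs
∈ᵇ-there x y xs y∈xs with y ≡ᵇ x
... | true  = refl
... | false = y∈xs

∉ᵇ-[] : ∀ y → ¬ y ∈ᵇ []
∉ᵇ-[] y ()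

∈ᵇ-∷⁻ : ∀ x y xs → y ∈ᵇ x ∷ xs → y ≡ x ⊎ y ∈ᵇ xs
∈ᵇ-∷⁻ x y xs y∈ with y ≡ᵇ x in e
... | true  = inj₁ (≡ᵇ-true⇒≡ y x e)
... | false = inj₂ y∈

∈ᵇ⇒∈ : ∀ y L → y ∈ᵇ L → y ∈ L
∈ᵇ⇒∈ y (x ∷ L) y∈ with ∈ᵇ-∷⁻ x y L y∈
... | inj₁ refl = here refl
... | inj₂ y∈L  = there (∈ᵇ⇒∈ y L y∈L)

∈⇒∈ᵇ : ∀ y L → y ∈ L → y ∈ᵇ L
∈⇒∈ᵇ y (x ∷ L) (here refl) = ∈ᵇ-here x L
∈⇒∈ᵇ y (x ∷ L) (there y∈) = ∈ᵇ-there x y L (∈⇒∈ᵇ y L y∈)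

memᵇ-diff : ∀ y A B → memᵇ y (diff A B) ≡ (memᵇ y A ∧ not (memᵇ y B))
memᵇ-diff y A B = memᵇ-filterᵇ (λ x → not (memᵇ x B)) y A

∈ᵇ-diff⁺ : ∀ y A B → y ∈ᵇ A → memᵇ y B ≡ false → y ∈ᵇ diff A B
∈ᵇ-diff⁺ y A B y∈A y∉B rewrite memᵇ-diff y A B | y∈A | y∉B = refl

∈ᵇ-diff⁻ : ∀ y A B → y ∈ᵇ diff A B → y ∈ᵇ A × memᵇ y B ≡ false
∈ᵇ-diff⁻ y A B y∈ rewrite memᵇ-diff y A B with memᵇ y A | memᵇ y B | y∈
... | true | false | _ = refl , refl

∈ᵇ-diff-false : ∀ y A B → y ∈ᵇ A → memᵇ y (diff A B) ≡ false → y ∈ᵇ B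
∈ᵇ-diff-false y A B y∈A y∉A∖B rewrite memᵇ-diff y A B | y∈A with memᵇ y B | y∉A∖B
... | true | _ = refl

-- The lexicographic order

data MinSpec (L : List ℕ) : Maybe ℕ → Set where
  none : L ≡ [] → MinSpec L nothing
  some : ∀ {m} → m ∈ᵇ L → (∀ y → y ∈ᵇ L → m ≤ y) → MinSpec L (just m)

minL-spec : ∀ L → MinSpec L (minL L)
minL-spec [] = none refl
minL-spec (x ∷ xs) with minL xs | minL-spec xs
... | nothing | none refl = some (∈ᵇ-here x []) x≤
  where x≤ : ∀ y → y ∈ᵇ x ∷ [] → x ≤ y
        x≤ y y∈ with ∈ᵇ-∷⁻ x y [] y∈
        ... | inj₁ refl = ≤-refl
... | just m | some m∈ m≤ with x <ᵇ m in x<ᵇm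
...   | true = some (∈ᵇ-here x xs) x≤
  where x≤ : ∀ y → y ∈ᵇ x ∷ xs → x ≤ y
        x≤ y y∈ with ∈ᵇ-∷⁻ x y xs y∈
        ... | inj₁ refl = ≤-refl
        ... | inj₂ y∈xs = ≤-trans (<⇒≤ (<ᵇ-true⇒< x m x<ᵇm)) (m≤ y y∈xs)
...   | false = some (∈ᵇ-there x m xs m∈) m≤′
  where m≤′ : ∀ y → y ∈ᵇ x ∷ xs → m ≤ y
        m≤′ y y∈ with ∈ᵇ-∷⁻ x y xs y∈
        ... | inj₁ refl = <ᵇ-false⇒≥ x m x<ᵇm
        ... | inj₂ y∈xs = m≤ y y∈xs

minL-cong : ∀ L L′ → (∀ y → memᵇ y L ≡ memᵇ y L′) → minL L ≡ minL L′
minL-cong L L′ L≗L′ with minL L | minL-spec L | minL L′ | minL-spec L′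
... | nothing | none _    | nothing | none _ = refl
... | nothing | none refl | just m′ | some m′∈ _ = ⊥-elim (≡true⇒≢false m′∈ (sym (L≗L′ m′)))
... | just m  | some m∈ _ | nothing | none refl = ⊥-elim (≡true⇒≢false m∈ (L≗L′ m))
... | just m  | some m∈ m≤ | just m′ | some m′∈ m′≤ =
  cong just (≤-antisym (m≤ m′ (trans (L≗L′ m′) m′∈)) (m′≤ m (trans (sym (L≗L′ m)) m∈)))

subsetᵇ-sound : ∀ A B → subsetᵇ B A ≡ true → ∀ y → y ∈ᵇ B → y ∈ᵇ A
subsetᵇ-sound A (x ∷ B) B⊆A y y∈ with memᵇ x A in x∈A | ∈ᵇ-∷⁻ x y B y∈
... | true | inj₁ refl = x∈A
... | true | inj₂ y∈B  = subsetᵇ-sound A B B⊆A y y∈B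

subsetᵇ-complete : ∀ A B → (∀ y → y ∈ᵇ B → y ∈ᵇ A) → subsetᵇ B A ≡ true
subsetᵇ-complete A []      B⊆A = refl
subsetᵇ-complete A (x ∷ B) B⊆A rewrite B⊆A x (∈ᵇ-here x B) =
  subsetᵇ-complete A B λ y y∈ → B⊆A y (∈ᵇ-there x y B y∈)

subsetᵇ-cong-diff : ∀ A B A′ B′ → (∀ y → memᵇ y (diff B A) ≡ memᵇ y (diff B′ A′)) →
  subsetᵇ B A ≡ subsetᵇ B′ A′
subsetᵇ-cong-diff A B A′ B′ same = ≡true⇔⇒≡ (transfer A B A′ B′ same) (transfer A′ B′ A B (λ y → sym (same y)))
  where
    transfer : ∀ A B A′ B′ → (∀ y → memᵇ y (diff B A) ≡ memᵇ y (diff B′ A′)) →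
      subsetᵇ B A ≡ true → subsetᵇ B′ A′ ≡ true
    transfer A B A′ B′ same B⊆A = subsetᵇ-complete A′ B′ λ y y∈B′ →
      ∈ᵇ-diff-false y B′ A′ y∈B′ (trans (sym (same y)) (not-in-diff y (memᵇ y (diff B A)) refl))
      where
        not-in-diff : ∀ y b → memᵇ y (diff B A) ≡ b → b ≡ false
        not-in-diff y false _    = refl
        not-in-diff y true  y∈ with ∈ᵇ-diff⁻ y B A y∈
        ... | y∈B , y∉A = ⊥-elim (≡true⇒≢false (subsetᵇ-sound A B B⊆A y y∈B) y∉A)

lexVerdict : Bool → Maybe ℕ → Maybe ℕ → Bool
lexVerdict true  _        _        = true
lexVerdict false (just a) (just b) = a <ᵇ b
lexVerdict false nothing  _        = false
lexVerdict false (just a) nothing  = false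

lexᵇ-unfold : ∀ A B → lexᵇ A B ≡ lexVerdict (subsetᵇ B A) (minL (diff A B)) (minL (diff B A))
lexᵇ-unfold A B with subsetᵇ B A | minL (diff A B) | minL (diff B A)
... | true  | _       | _       = refl
... | false | just a  | just b  = refl
... | false | nothing | _       = refl
... | false | just a  | nothing = refl

lexᵇ-cong-diff : ∀ A B A′ B′ → (∀ y → memᵇ y (diff A B) ≡ memᵇ y (diff A′ B′))
  → (∀ y → memᵇ y (diff B A) ≡ memᵇ y (diff B′ A′)) → lexᵇ A B ≡ lexᵇ A′ B′
lexᵇ-cong-diff A B A′ B′ sameAB sameBA rewrite lexᵇ-unfold A B | lexᵇ-unfold A′ B′ =
  trans (cong₂ (λ s m → lexVerdict s m (minL (diff B A)))
               (subsetᵇ-cong-diff A B A′ B′ sameBA) (minL-cong (diff A B) (diff A′ B′) sameAB))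
        (cong (lexVerdict (subsetᵇ B′ A′) (minL (diff A′ B′))) (minL-cong (diff B A) (diff B′ A′) sameBA))

lexᵇ-min-left : ∀ x A B → x ∈ᵇ A → memᵇ x B ≡ false → (∀ y → y ∈ᵇ B → x ≤ y) → lexᵇ A B ≡ true
lexᵇ-min-left x A B x∈A x∉B x≤B rewrite lexᵇ-unfold A B with subsetᵇ B A in B⊆ᵇA
... | true = refl
... | false with minL (diff A B) | minL-spec (diff A B) | minL (diff B A) | minL-spec (diff B A)
...   | nothing | none A∖B≡[] | _ | _ = ⊥-elim (∉ᵇ-[] x (subst (x ∈ᵇ_) A∖B≡[] (∈ᵇ-diff⁺ x A B x∈A x∉B)))
...   | just a  | some _ _    | nothing | none B∖A≡[] =
  ⊥-elim (≡true⇒≢false (subsetᵇ-complete A B λ y y∈B → ∈ᵇ-diff-false y B A y∈B (cong (memᵇ y) B∖A≡[])) B⊆ᵇA)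
...   | just a  | some _ a≤   | just b  | some b∈ _ = <⇒<ᵇ-true (≤-<-trans (a≤ x (∈ᵇ-diff⁺ x A B x∈A x∉B)) x<b)
  where
    b∈B : b ∈ᵇ B
    b∈B = proj₁ (∈ᵇ-diff⁻ b B A b∈)
    x<b : x < b
    x<b = ≤∧≢⇒< (x≤B b b∈B) λ { refl → ≡true⇒≢false b∈B x∉B }

lexᵇ-min-right : ∀ x A B → x ∈ᵇ B → memᵇ x A ≡ false → (∀ y → y ∈ᵇ A → x < y) → lexᵇ A B ≡ false
lexᵇ-min-right x A B x∈B x∉A x<A rewrite lexᵇ-unfold A B with subsetᵇ B A in B⊆ᵇA
... | true = ⊥-elim (≡true⇒≢false (subsetᵇ-sound A B B⊆ᵇA x x∈B) x∉A)
... | false with minL (diff A B) | minL-spec (diff A B) | minL (diff B A) | minL-spec (diff B A)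
...   | nothing | _        | _       | _ = refl
...   | just a  | some _ _ | nothing | none B∖A≡[] = ⊥-elim (∉ᵇ-[] x (subst (x ∈ᵇ_) B∖A≡[] (∈ᵇ-diff⁺ x B A x∈B x∉A)))
...   | just a  | some a∈ _ | just b | some _ b≤ =
  ≥⇒<ᵇ-false (≤-trans (b≤ x (∈ᵇ-diff⁺ x B A x∈B x∉A)) (<⇒≤ (x<A a (proj₁ (∈ᵇ-diff⁻ a A B a∈)))))

rm : ℕ → List ℕ → List ℕ
rm x L = filterᵇ (λ y → not (y ≡ᵇ x)) L

memᵇ-rm : ∀ x y L → memᵇ y (rm x L) ≡ (memᵇ y L ∧ not (y ≡ᵇ x))
memᵇ-rm x y L = memᵇ-filterᵇ (λ z → not (z ≡ᵇ x)) y L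

lexᵇ-rm-common : ∀ x A B → x ∈ᵇ A → x ∈ᵇ B → lexᵇ A B ≡ lexᵇ (rm x A) (rm x B)
lexᵇ-rm-common x A B x∈A x∈B = lexᵇ-cong-diff A B (rm x A) (rm x B) (same A B x∈B) (same B A x∈A)
  where
    same : ∀ P Q → x ∈ᵇ Q → ∀ y → memᵇ y (diff P Q) ≡ memᵇ y (diff (rm x P) (rm x Q))
    same P Q x∈Q y rewrite memᵇ-diff y P Q | memᵇ-diff y (rm x P) (rm x Q) | memᵇ-rm x y P | memᵇ-rm x y Q
      with y ≡ᵇ x in y≡ᵇx
    ... | true rewrite ≡ᵇ-true⇒≡ y x y≡ᵇx | x∈Q | ∧-zeroʳ (memᵇ x P) = refl
    ... | false rewrite ∧-identityʳ (memᵇ y P) | ∧-identityʳ (memᵇ y Q) = refl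

-- Comparing subsets of a segment position by position

χ : List ℕ → ℕ → Bool
χ A y = memᵇ y A

seg : ℕ → ℕ → List ℕ
seg a zero    = []
seg a (suc m) = a ∷ seg (suc a) m

WithinSeg : ℕ → ℕ → List ℕ → Set
WithinSeg c m A = ∀ y → y ∈ᵇ A → c ≤ y × y < c + m

∈ᵇ-seg⁻ : ∀ a m y → y ∈ᵇ seg a m → a ≤ y × y < a + m
∈ᵇ-seg⁻ a (suc m) y y∈ with ∈ᵇ-∷⁻ a y (seg (suc a) m) y∈
... | inj₁ refl = ≤-refl , m<m+n a z<s
... | inj₂ y∈′ with ∈ᵇ-seg⁻ (suc a) m y y∈′
...   | a<y , y<  = <⇒≤ a<y , subst (y <_) (sym (+-suc a m)) y<

∈ᵇ-seg⁺ : ∀ a m y → a ≤ y → y < a + m → y ∈ᵇ seg a m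
∈ᵇ-seg⁺ a zero    y a≤y y< = ⊥-elim (<⇒≱ y< (subst (_≤ y) (sym (+-identityʳ a)) a≤y))
∈ᵇ-seg⁺ a (suc m) y a≤y y< with a ≟ y
... | yes refl = ∈ᵇ-here a (seg (suc a) m)
... | no a≢y   =
  ∈ᵇ-there a y (seg (suc a) m) (∈ᵇ-seg⁺ (suc a) m y (≤∧≢⇒< a≤y a≢y) (subst (y <_) (+-suc a m) y<))

WithinSeg-zero⇒[] : ∀ c A → WithinSeg c 0 A → A ≡ []
WithinSeg-zero⇒[] c []      _  = refl
WithinSeg-zero⇒[] c (x ∷ A) in-c with in-c x (∈ᵇ-here x A)
... | c≤x , x<c+0 = ⊥-elim (<⇒≱ x<c+0 (subst (_≤ x) (sym (+-identityʳ c)) c≤x))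

WithinSeg-rm : ∀ c m R → WithinSeg c (suc m) R → WithinSeg (suc c) m (rm c R)
WithinSeg-rm c m R in-c y y∈ with ∧-≡true⁻ {memᵇ y R} (trans (sym (memᵇ-rm c y R)) y∈)
... | y∈R , y≢c with in-c y y∈R
...   | c≤y , y< =
  ≤∧≢⇒< c≤y (λ { refl → ≡true⇒≢false y≢c (cong not (≡ᵇ-refl c)) }) , subst (y <_) (+-suc c m) y<

WithinSeg-suc : ∀ c m R → WithinSeg c (suc m) R → memᵇ c R ≡ false → WithinSeg (suc c) m R
WithinSeg-suc c m R in-c c∉R y y∈ with in-c y y∈
... | c≤y , y< = ≤∧≢⇒< c≤y (λ { refl → ≡true⇒≢false y∈ c∉R }) , subst (y <_) (+-suc c m) y<

memᵇ-rm-seg : ∀ c m P y → y ∈ᵇ seg (suc c) m → memᵇ y (rm c P) ≡ memᵇ y P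
memᵇ-rm-seg c m P y y∈ = trans (memᵇ-rm c y P)
  (trans (cong (λ b → memᵇ y P ∧ not b)
                (≢⇒≡ᵇ-false {y} {c} λ { refl → <-irrefl refl (proj₁ (∈ᵇ-seg⁻ (suc c) m y y∈)) }))
         (∧-identityʳ _))

lexScan : (ℕ → Bool) → (ℕ → Bool) → List ℕ → Bool
lexScan a b []       = true
lexScan a b (x ∷ xs) = if a x then (if b x then lexScan a b xs else true)
                              else (if b x then false else lexScan a b xs)

lexScan-cong : ∀ L a a′ b b′ → (∀ y → y ∈ᵇ L → a y ≡ a′ y) → (∀ y → y ∈ᵇ L → b y ≡ b′ y) →
  lexScan a b L ≡ lexScan a′ b′ L
lexScan-cong []      a a′ b b′ a≗ b≗ = refl
lexScan-cong (x ∷ L) a a′ b b′ a≗ b≗ rewrite a≗ x (∈ᵇ-here x L) | b≗ x (∈ᵇ-here x L)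
  | lexScan-cong L a a′ b b′ (λ y y∈ → a≗ y (∈ᵇ-there x y L y∈)) (λ y y∈ → b≗ y (∈ᵇ-there x y L y∈))
  = refl

lexScan-refl : ∀ L a → lexScan a a L ≡ true
lexScan-refl []      a = refl
lexScan-refl (x ∷ L) a with a x
... | true  = lexScan-refl L a
... | false = lexScan-refl L a

lexScan-trans : ∀ L a b c → lexScan a b L ≡ true → lexScan b c L ≡ true → lexScan a c L ≡ true
lexScan-trans []      a b c _   _   = refl
lexScan-trans (x ∷ L) a b c a≤b b≤c with a x | b x | c x
... | true  | true  | true  = lexScan-trans L a b c a≤b b≤c
... | true  | true  | false = refl
... | true  | false | false = refl
... | false | false | false = lexScan-trans L a b c a≤b b≤c

lexScan-total : ∀ L a b → lexScan a b L ≡ false → lexScan b a L ≡ true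
lexScan-total (x ∷ L) a b a≰b with a x | b x
... | true  | true  = lexScan-total L a b a≰b
... | false | true  = refl
... | false | false = lexScan-total L a b a≰b

-- Peel off the least element c of the segment: if it lies in both sets it can be removed,
-- if it lies in exactly one it decides the comparison, otherwise the segment shrinks.
lexᵇ≡lexScan : ∀ m c A B → WithinSeg c m A → WithinSeg c m B → lexᵇ A B ≡ lexScan (χ A) (χ B) (seg c m)
lexᵇ≡lexScan zero c A B inA inB rewrite WithinSeg-zero⇒[] c A inA | WithinSeg-zero⇒[] c B inB = refl
lexᵇ≡lexScan (suc m) c A B inA inB = by-cases (memᵇ c A) refl (memᵇ c B) refl
  where
    xs : List ℕ
    xs = seg (suc c) m
    unfold : ∀ u v → memᵇ c A ≡ u → memᵇ c B ≡ v →
      lexScan (χ A) (χ B) (c ∷ xs) ≡ (if u then (if v then lexScan (χ A) (χ B) xs else true)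
                                             else (if v then false else lexScan (χ A) (χ B) xs))
    unfold u v refl refl = refl
    by-cases : ∀ u → memᵇ c A ≡ u → ∀ v → memᵇ c B ≡ v → lexᵇ A B ≡ lexScan (χ A) (χ B) (c ∷ xs)
    by-cases true c∈A true c∈B = begin
      lexᵇ A B                              ≡⟨ lexᵇ-rm-common c A B c∈A c∈B ⟩
      lexᵇ (rm c A) (rm c B)                ≡⟨ lexᵇ≡lexScan m (suc c) (rm c A) (rm c B)
                                                  (WithinSeg-rm c m A inA) (WithinSeg-rm c m B inB) ⟩
      lexScan (χ (rm c A)) (χ (rm c B)) xs  ≡⟨ lexScan-cong xs _ _ _ _ (memᵇ-rm-seg c m A) (memᵇ-rm-seg c m B) ⟩
      lexScan (χ A) (χ B) xs                ≡⟨ unfold true true c∈A c∈B ⟨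
      lexScan (χ A) (χ B) (c ∷ xs)          ∎
      where open ≡-Reasoning
    by-cases true c∈A false c∉B =
      trans (lexᵇ-min-left c A B c∈A c∉B (λ y y∈ → proj₁ (inB y y∈))) (sym (unfold true false c∈A c∉B))
    by-cases false c∉A true c∈B =
      trans (lexᵇ-min-right c A B c∈B c∉A λ y y∈ → ≤∧≢⇒< (proj₁ (inA y y∈)) λ { refl → ≡true⇒≢false y∈ c∉A })
            (sym (unfold false true c∉A c∈B))
    by-cases false c∉A false c∉B =
      trans (lexᵇ≡lexScan m (suc c) A B (WithinSeg-suc c m A inA c∉A) (WithinSeg-suc c m B inB c∉B))
            (sym (unfold false false c∉A c∉B))

module _ (c m : ℕ) where

  lexᵇ-refl : ∀ A → WithinSeg c m A → lexᵇ A A ≡ true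
  lexᵇ-refl A inA = trans (lexᵇ≡lexScan m c A A inA inA) (lexScan-refl (seg c m) _)

  lexᵇ-trans : ∀ A B D → WithinSeg c m A → WithinSeg c m B → WithinSeg c m D →
    lexᵇ A B ≡ true → lexᵇ B D ≡ true → lexᵇ A D ≡ true
  lexᵇ-trans A B D inA inB inD A≼B B≼D = trans (lexᵇ≡lexScan m c A D inA inD)
    (lexScan-trans (seg c m) _ _ _ (trans (sym (lexᵇ≡lexScan m c A B inA inB)) A≼B)
                                   (trans (sym (lexᵇ≡lexScan m c B D inB inD)) B≼D))

  lexᵇ-total : ∀ A B → WithinSeg c m A → WithinSeg c m B → lexᵇ A B ≡ false → lexᵇ B A ≡ true
  lexᵇ-total A B inA inB A⋠B = trans (lexᵇ≡lexScan m c B A inB inA)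
    (lexScan-total (seg c m) _ _ (trans (sym (lexᵇ≡lexScan m c A B inA inB)) A⋠B))

-- Counting the k-sets below a set

length-choose : ∀ k L → length (choose k L) ≡ length L C k
length-choose zero    L       = refl
length-choose (suc k) []      = refl
length-choose (suc k) (x ∷ L) = begin
  length (map (x ∷_) (choose k L) ++ choose (suc k) L)    ≡⟨ length-++ (map (x ∷_) (choose k L)) ⟩
  length (map (x ∷_) (choose k L)) + length (choose (suc k) L)
    ≡⟨ cong₂ _+_ (trans (length-map (x ∷_) (choose k L)) (length-choose k L)) (length-choose (suc k) L) ⟩
  length L C k + length L C suc k                         ≡⟨ pascal (length L) k ⟩
  suc (length L) C suc k                                  ∎
  where open ≡-Reasoning

choose-⊆ : ∀ k L F → F ∈ choose k L → ∀ y → y ∈ᵇ F → y ∈ᵇ L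
choose-⊆ zero    L       .[] (here refl) y ()
choose-⊆ (suc k) (x ∷ L) F F∈ y y∈F with ∈-++⁻ (map (x ∷_) (choose k L)) F∈
... | inj₂ F∈′ = ∈ᵇ-there x y L (choose-⊆ (suc k) L F F∈′ y y∈F)
... | inj₁ F∈′ with ∈-map⁻ (x ∷_) F∈′
...   | F′ , F′∈ , refl with ∈ᵇ-∷⁻ x y F′ y∈F
...     | inj₁ refl = ∈ᵇ-here x L
...     | inj₂ y∈F′ = ∈ᵇ-there x y L (choose-⊆ k L F′ F′∈ y y∈F′)

filterᵇ-cong : ∀ {A : Set} (p q : A → Bool) xs → (∀ z → z ∈ xs → p z ≡ q z) → filterᵇ p xs ≡ filterᵇ q xs
filterᵇ-cong p q []       p≗q = refl
filterᵇ-cong p q (x ∷ xs) p≗q with p x | q x | p≗q x (here refl)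
... | true  | true  | _ = cong (x ∷_) (filterᵇ-cong p q xs λ z z∈ → p≗q z (there z∈))
... | false | false | _ = filterᵇ-cong p q xs λ z z∈ → p≗q z (there z∈)

length-filterᵇ-map : ∀ {A B : Set} (p : B → Bool) (f : A → B) xs →
  length (filterᵇ p (map f xs)) ≡ length (filterᵇ (λ z → p (f z)) xs)
length-filterᵇ-map p f []       = refl
length-filterᵇ-map p f (x ∷ xs) with p (f x)
... | true  = cong suc (length-filterᵇ-map p f xs)
... | false = length-filterᵇ-map p f xs

-- lexRank k bs is the number of k-subsets of the positions of bs that are ≼ the set R with
-- characteristic vector bs: a k-set differing from R at the first position is ≼ R exactly
-- when it contains that position.
lexRank : ℕ → List Bool → ℕ
lexRank zero    []       = 1
lexRank (suc k) []       = 0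
lexRank zero    (b ∷ bs) = if b then 0 else lexRank zero bs
lexRank (suc k) (b ∷ bs) = if b then lexRank k bs else length bs C k + lexRank (suc k) bs

lexRank-zero : ∀ r L → lexRank 0 (map r L) ≡ (if lexScan (λ _ → false) r L then 1 else 0)
lexRank-zero r []      = refl
lexRank-zero r (x ∷ L) with r x
... | true  = refl
... | false = lexRank-zero r L

private
  count-empty : ∀ r L → length (filterᵇ (λ F → lexScan (χ F) r L) ([] ∷ [])) ≡ lexRank 0 (map r L)
  count-empty r L rewrite lexRank-zero r L with lexScan (λ _ → false) r L
  ... | true  = refl
  ... | false = refl

module _ (c m : ℕ) (r : ℕ → Bool) where

  private
    xs : List ℕ
    xs = seg (suc c) m

  lexScan-∷-head : ∀ F → (∀ y → y ∈ᵇ F → y ∈ᵇ xs) →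
    lexScan (χ (c ∷ F)) r (c ∷ xs) ≡ (if r c then lexScan (χ F) r xs else true)
  lexScan-∷-head F F⊆xs rewrite ≡ᵇ-refl c =
    cong (λ b → if r c then b else true) (lexScan-cong xs _ _ r r χ-c∷ (λ _ _ → refl))
    where
      χ-c∷ : ∀ y → y ∈ᵇ xs → χ (c ∷ F) y ≡ χ F y
      χ-c∷ y y∈ with y ≡ᵇ c in y≡ᵇc
      ... | true  = ⊥-elim (<-irrefl (sym (≡ᵇ-true⇒≡ y c y≡ᵇc)) (proj₁ (∈ᵇ-seg⁻ (suc c) m y y∈)))
      ... | false = refl

  private
    ∉-head : ∀ F → (∀ y → y ∈ᵇ F → y ∈ᵇ xs) → memᵇ c F ≡ false
    ∉-head F F⊆xs with memᵇ c F in c∈F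
    ... | false = refl
    ... | true  = ⊥-elim (<-irrefl refl (proj₁ (∈ᵇ-seg⁻ (suc c) m c (F⊆xs c c∈F))))

  lexScan-∉-head : ∀ F → (∀ y → y ∈ᵇ F → y ∈ᵇ xs) →
    lexScan (χ F) r (c ∷ xs) ≡ (if r c then false else lexScan (χ F) r xs)
  lexScan-∉-head F F⊆xs rewrite ∉-head F F⊆xs = refl

length-filter-lexScan : ∀ m c k (r : ℕ → Bool) →
  length (filterᵇ (λ F → lexScan (χ F) r (seg c m)) (choose k (seg c m))) ≡ lexRank k (map r (seg c m))
length-filter-lexScan m       c zero    r = count-empty r (seg c m)
length-filter-lexScan zero    c (suc k) r = refl
length-filter-lexScan (suc m) c (suc k) r = begin
  length (filterᵇ p (map (c ∷_) (choose k xs) ++ choose (suc k) xs))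
    ≡⟨ cong length (filter-++ (λ F → T? (p F)) (map (c ∷_) (choose k xs)) (choose (suc k) xs)) ⟩
  length (filterᵇ p (map (c ∷_) (choose k xs)) ++ filterᵇ p (choose (suc k) xs))
    ≡⟨ length-++ (filterᵇ p (map (c ∷_) (choose k xs))) ⟩
  length (filterᵇ p (map (c ∷_) (choose k xs))) + length (filterᵇ p (choose (suc k) xs))
    ≡⟨ cong₂ _+_ (trans (length-filterᵇ-map p (c ∷_) (choose k xs))
                        (cong length (filterᵇ-cong _ _ _ λ F F∈ → lexScan-∷-head c m r F (⊆xs k F F∈))))
                 (cong length (filterᵇ-cong _ _ _ λ F F∈ → lexScan-∉-head c m r F (⊆xs (suc k) F F∈))) ⟩
  length (filterᵇ (λ F → if r c then lexScan (χ F) r xs else true) (choose k xs))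
    + length (filterᵇ (λ F → if r c then false else lexScan (χ F) r xs) (choose (suc k) xs))
    ≡⟨ by-cases (r c) ⟩
  lexRank (suc k) (map r (c ∷ xs)) ∎
  where
    open ≡-Reasoning
    xs : List ℕ
    xs = seg (suc c) m
    p : List ℕ → Bool
    p F = lexScan (χ F) r (c ∷ xs)
    ⊆xs : ∀ k′ F → F ∈ choose k′ xs → ∀ y → y ∈ᵇ F → y ∈ᵇ xs
    ⊆xs k′ F F∈ = choose-⊆ k′ xs F F∈
    by-cases : ∀ b → length (filterᵇ (λ F → if b then lexScan (χ F) r xs else true) (choose k xs))
                     + length (filterᵇ (λ F → if b then false else lexScan (χ F) r xs) (choose (suc k) xs))
                   ≡ lexRank (suc k) (b ∷ map r xs)
    by-cases true = trans
      (cong₂ _+_ (length-filter-lexScan m (suc c) k r)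
                 (cong length (filter-none (λ _ → T? false) (All.universal (λ _ ()) (choose (suc k) xs)))))
      (+-identityʳ _)
    by-cases false = cong₂ _+_
      (begin
        length (filterᵇ (λ _ → true) (choose k xs))
          ≡⟨ cong length (filter-all (λ _ → T? true) (All.universal _ (choose k xs))) ⟩
        length (choose k xs)                        ≡⟨ length-choose k xs ⟩
        length xs C k                               ≡⟨ cong (_C k) (length-map r xs) ⟨
        length (map r xs) C k                       ∎)
      (length-filter-lexScan m (suc c) (suc k) r)

applyUpTo≡seg : ∀ m (f : ℕ → ℕ) a → (∀ i → f i ≡ a + i) → applyUpTo f m ≡ seg a m
applyUpTo≡seg zero    f a f≗ = refl
applyUpTo≡seg (suc m) f a f≗ = cong₂ _∷_ (trans (f≗ 0) (+-identityʳ a))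
  (applyUpTo≡seg m (λ i → f (suc i)) (suc a) λ i → trans (f≗ (suc i)) (+-suc a i))

range≡seg : ∀ a b → range a b ≡ seg a (suc b ∸ a)
range≡seg a b = trans (map-applyUpTo (λ i → i) (a +_) (suc b ∸ a)) (applyUpTo≡seg _ _ a λ i → refl)

kSubsets-within : ∀ n k F → F ∈ kSubsets n k → WithinSeg 1 n F
kSubsets-within n k F F∈ y y∈ = ∈ᵇ-seg⁻ 1 n y (subst (y ∈ᵇ_) (range≡seg 1 n) (choose-⊆ k (range 1 n) F F∈ y y∈))

Lcount≡lexRank : ∀ n k R → WithinSeg 1 n R → Lcount n k R ≡ lexRank k (map (χ R) (seg 1 n))
Lcount≡lexRank n k R inR = begin
  length (filterᵇ (λ F → lexᵇ F R) (kSubsets n k))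
    ≡⟨ cong length (filterᵇ-cong _ _ _ λ F F∈ → lexᵇ≡lexScan n 1 F R (kSubsets-within n k F F∈) inR) ⟩
  length (filterᵇ (λ F → lexScan (χ F) (χ R) (seg 1 n)) (choose k (range 1 n)))
    ≡⟨ cong (λ L → length (filterᵇ (λ F → lexScan (χ F) (χ R) (seg 1 n)) (choose k L))) (range≡seg 1 n) ⟩
  length (filterᵇ (λ F → lexScan (χ F) (χ R) (seg 1 n)) (choose k (seg 1 n)))
    ≡⟨ length-filter-lexScan n 1 k (χ R) ⟩
  lexRank k (map (χ R) (seg 1 n)) ∎
  where open ≡-Reasoning

module _ (c m : ℕ) (P : List ℕ → Set) (P-within : ∀ K → P K → WithinSeg c m K) where

  private
    step : List ℕ → List ℕ → List ℕ
    step acc K = if lexᵇ acc K then K else acc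

  foldl-lexMax : ∀ Ks acc → P acc → (∀ K → K ∈ Ks → P K) →
    P (foldl step acc Ks) × lexᵇ acc (foldl step acc Ks) ≡ true × (∀ K → K ∈ Ks → lexᵇ K (foldl step acc Ks) ≡ true)
  foldl-lexMax [] acc P-acc _ = P-acc , lexᵇ-refl c m acc (P-within acc P-acc) , λ _ ()
  foldl-lexMax (K ∷ Ks) acc P-acc P-Ks with lexᵇ acc K in acc≼K
  ... | true with foldl-lexMax Ks K (P-Ks K (here refl)) (λ K′ K′∈ → P-Ks K′ (there K′∈))
  ...   | P-max , K≼max , Ks≼max = P-max , acc≼max , all≼max
    where
      acc≼max : lexᵇ acc (foldl step K Ks) ≡ true
      acc≼max = lexᵇ-trans c m acc K (foldl step K Ks)
                  (P-within acc P-acc) (P-within K (P-Ks K (here refl))) (P-within _ P-max) acc≼K K≼max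
      all≼max : ∀ K′ → K′ ∈ K ∷ Ks → lexᵇ K′ (foldl step K Ks) ≡ true
      all≼max K′ (here refl) = K≼max
      all≼max K′ (there K′∈) = Ks≼max K′ K′∈
  foldl-lexMax (K ∷ Ks) acc P-acc P-Ks | false with foldl-lexMax Ks acc P-acc (λ K′ K′∈ → P-Ks K′ (there K′∈))
  ...   | P-max , acc≼max , Ks≼max = P-max , acc≼max , all≼max
    where
      all≼max : ∀ K′ → K′ ∈ K ∷ Ks → lexᵇ K′ (foldl step acc Ks) ≡ true
      all≼max K′ (here refl) = lexᵇ-trans c m K acc (foldl step acc Ks)
                                 (P-within K (P-Ks K (here refl))) (P-within acc P-acc) (P-within _ P-max)
                                 (lexᵇ-total c m acc K (P-within acc P-acc) (P-within K (P-Ks K (here refl))) acc≼K) acc≼max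
      all≼max K′ (there K′∈) = Ks≼max K′ K′∈

Lcount-lexLast : ∀ n k H → WithinSeg 1 n H → 0 < Lcount n k H →
  Lcount n k (lexLast (filterᵇ (λ K → lexᵇ K H) (kSubsets n k))) ≡ Lcount n k H
Lcount-lexLast n k H inH pos = go (filterᵇ (λ K → lexᵇ K H) S) refl pos
  where
    S : List (List ℕ)
    S = kSubsets n k
    Below : List ℕ → Set
    Below K = K ∈ S × lexᵇ K H ≡ true
    Below-within : ∀ K → Below K → WithinSeg 1 n K
    Below-within K (K∈S , _) = kSubsets-within n k K K∈S
    go : ∀ Ks → filterᵇ (λ K → lexᵇ K H) S ≡ Ks → 0 < length Ks → Lcount n k (lexLast Ks) ≡ Lcount n k H
    go (K₀ ∷ Ks) S≼H≡ _ = cong length (filterᵇ-cong _ _ S λ F F∈ → ≡true⇔⇒≡ (≼max⇒≼H F F∈) (≼H⇒≼max F F∈))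
      where
        below : ∀ K → K ∈ K₀ ∷ Ks → Below K
        below K K∈ with ∈-filter⁻ (λ K → T? (lexᵇ K H)) (subst (K ∈_) (sym S≼H≡) K∈)
        ... | K∈S , K≼H = K∈S , to T-≡ K≼H
        max : List ℕ
        max = lexLast (K₀ ∷ Ks)
        isMax : Below max × lexᵇ K₀ max ≡ true × (∀ K → K ∈ Ks → lexᵇ K max ≡ true)
        isMax = foldl-lexMax 1 n Below Below-within Ks K₀ (below K₀ (here refl)) (λ K K∈ → below K (there K∈))
        ≼max⇒≼H : ∀ F → F ∈ S → lexᵇ F max ≡ true → lexᵇ F H ≡ true
        ≼max⇒≼H F F∈ F≼max = lexᵇ-trans 1 n F max H (kSubsets-within n k F F∈) (Below-within max (proj₁ isMax)) inH
                               F≼max (proj₂ (proj₁ isMax))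
        ≼H⇒≼max : ∀ F → F ∈ S → lexᵇ F H ≡ true → lexᵇ F max ≡ true
        ≼H⇒≼max F F∈ F≼H with subst (F ∈_) S≼H≡ (∈-filter⁺ (λ K → T? (lexᵇ K H)) F∈ (from T-≡ F≼H))
        ... | here refl = proj₁ (proj₂ isMax)
        ... | there F∈Ks = proj₂ (proj₂ isMax) F F∈Ks

-- Characteristic vectors made of runs

Runs : Set
Runs = List (Bool × ℕ)

expand : Runs → List Bool
expand []             = []
expand ((b , l) ∷ rs) = replicate l b ++ expand rs

total : Runs → ℕ
total []             = 0
total ((b , l) ∷ rs) = l + total rs

RunsOf : (ℕ → Bool) → ℕ → Runs → Set
RunsOf f c []             = ⊤
RunsOf f c ((b , l) ∷ rs) = (∀ y → c ≤ y → y < c + l → f y ≡ b) × RunsOf f (c + l) rs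

length-expand : ∀ rs → length (expand rs) ≡ total rs
length-expand []             = refl
length-expand ((b , l) ∷ rs) = trans (length-++ (replicate l b)) (cong₂ _+_ (length-replicate l) (length-expand rs))

seg-++ : ∀ c p q → seg c (p + q) ≡ seg c p ++ seg (c + p) q
seg-++ c zero    q = cong (λ c′ → seg c′ q) (sym (+-identityʳ c))
seg-++ c (suc p) q = cong (c ∷_) (trans (seg-++ (suc c) p q) (cong (λ c′ → seg (suc c) p ++ seg c′ q) (sym (+-suc c p))))

map-seg-const : ∀ (f : ℕ → Bool) b c l → (∀ y → c ≤ y → y < c + l → f y ≡ b) → map f (seg c l) ≡ replicate l b
map-seg-const f b c zero    f≡b = refl
map-seg-const f b c (suc l) f≡b = cong₂ _∷_ (f≡b c ≤-refl (m<m+n c z<s))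
  (map-seg-const f b (suc c) l λ y c<y y< → f≡b y (<⇒≤ c<y) (subst (y <_) (sym (+-suc c l)) y<))

map-seg-runs : ∀ f c rs → RunsOf f c rs → map f (seg c (total rs)) ≡ expand rs
map-seg-runs f c []             _            = refl
map-seg-runs f c ((b , l) ∷ rs) (f≡b , rest) rewrite seg-++ c l (total rs) | map-++ f (seg c l) (seg (c + l) (total rs)) =
  cong₂ _++_ (map-seg-const f b c l f≡b) (map-seg-runs f (c + l) rs rest)

RunsOf-cong : ∀ f g c rs → (∀ y → c ≤ y → y < c + total rs → g y ≡ f y) → RunsOf f c rs → RunsOf g c rs
RunsOf-cong f g c []             _   _            = tt
RunsOf-cong f g c ((b , l) ∷ rs) g≗f (f≡b , rest) =
  (λ y c≤y y< → trans (g≗f y c≤y (<-≤-trans y< (c+l≤ c l (total rs)))) (f≡b y c≤y y<)) ,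
  RunsOf-cong f g (c + l) rs
    (λ y c+l≤y y< → g≗f y (≤-trans (m≤m+n c l) c+l≤y) (subst (y <_) (+-assoc c l (total rs)) y<)) rest
  where
    c+l≤ : ∀ c l t → c + l ≤ c + (l + t)
    c+l≤ c l t = subst (c + l ≤_) (+-assoc c l t) (m≤m+n (c + l) t)

empty-run : ∀ (f : ℕ → Bool) b c y → c ≤ y → y < c + 0 → f y ≡ b
empty-run f b c y c≤y y<c+0 = ⊥-elim (<⇒≱ y<c+0 (subst (_≤ y) (sym (+-identityʳ c)) c≤y))

RunsOf-++ : ∀ f c rs₁ rs₂ → RunsOf f c rs₁ → RunsOf f (c + total rs₁) rs₂ → RunsOf f c (rs₁ ++ rs₂)
RunsOf-++ f c []               rs₂ _            r₂ = subst (λ c′ → RunsOf f c′ rs₂) (+-identityʳ c) r₂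
RunsOf-++ f c ((b , l) ∷ rs₁)  rs₂ (f≡b , r₁) r₂ =
  f≡b , RunsOf-++ f (c + l) rs₁ rs₂ r₁ (subst (λ c′ → RunsOf f c′ rs₂) (sym (+-assoc c l (total rs₁))) r₂)

Lcount-runs : ∀ n k X rs → WithinSeg 1 n X → total rs ≡ n → RunsOf (χ X) 1 rs → Lcount n k X ≡ lexRank k (expand rs)
Lcount-runs n k X rs inX refl X-runs =
  trans (Lcount≡lexRank (total rs) k X inX) (cong (lexRank k) (map-seg-runs (χ X) 1 rs X-runs))

C-pos : ∀ n k → k ≤ n → 0 < n C k
C-pos n       zero    _         = z<s
C-pos (suc n) (suc k) (s≤s k≤n) =
  ≤-trans (C-pos n k k≤n) (≤-trans (m≤m+n (n C k) (n C suc k)) (≤-reflexive (pascal n k)))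

private
  false-run : ∀ p k bs → lexRank k (replicate p false ++ bs) + length bs C k ≡ (p + length bs) C k + lexRank k bs
  false-run zero    k       bs = +-comm (lexRank k bs) (length bs C k)
  false-run (suc p) zero    bs = false-run p zero bs
  false-run (suc p) (suc k) bs rewrite length-++ (replicate p false) {bs} | length-replicate p {false} = begin
    (p + length bs) C k + lexRank (suc k) (replicate p false ++ bs) + length bs C suc k
      ≡⟨ +-assoc ((p + length bs) C k) _ _ ⟩
    (p + length bs) C k + (lexRank (suc k) (replicate p false ++ bs) + length bs C suc k)
      ≡⟨ cong ((p + length bs) C k +_) (false-run p (suc k) bs) ⟩
    (p + length bs) C k + ((p + length bs) C suc k + lexRank (suc k) bs)
      ≡⟨ +-assoc ((p + length bs) C k) _ _ ⟨
    (p + length bs) C k + (p + length bs) C suc k + lexRank (suc k) bs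
      ≡⟨ cong (_+ lexRank (suc k) bs) (pascal (p + length bs) k) ⟩
    suc (p + length bs) C suc k + lexRank (suc k) bs ∎
    where open ≡-Reasoning

lexRank-false-run : ∀ p k bs {N} → length bs ≡ N → lexRank k (replicate p false ++ bs) + N C k ≡ (p + N) C k + lexRank k bs
lexRank-false-run p k bs refl = false-run p k bs

lexRank-true-run : ∀ p k bs → lexRank (p + k) (replicate p true ++ bs) ≡ lexRank k bs
lexRank-true-run zero    k bs = refl
lexRank-true-run (suc p) k bs = lexRank-true-run p k bs

lexRank-long-true-run : ∀ p k bs → k < p → lexRank k (replicate p true ++ bs) ≡ 0
lexRank-long-true-run (suc p) zero    bs _         = refl
lexRank-long-true-run (suc p) (suc k) bs (s≤s k<p) = lexRank-long-true-run p k bs k<p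

lexRank-all-true : ∀ p → lexRank p (replicate p true) ≡ 1
lexRank-all-true zero    = refl
lexRank-all-true (suc p) = lexRank-all-true p

-- The set occupying the last k positions is ≽ every k-set.
lexRank-last : ∀ p k → lexRank k (expand ((false , p) ∷ (true , k) ∷ [])) ≡ (p + k) C k
lexRank-last p k = +-cancelʳ-≡ 1 _ _ (begin
  lexRank k (replicate p false ++ Tk) + 1      ≡⟨ cong (lexRank k (replicate p false ++ Tk) +_) (nCn≡1 k) ⟨
  lexRank k (replicate p false ++ Tk) + k C k  ≡⟨ lexRank-false-run p k Tk |Tk| ⟩
  (p + k) C k + lexRank k Tk                   ≡⟨ cong ((p + k) C k +_) (trans (cong (lexRank k) (++-identityʳ _))
                                                                           (lexRank-all-true k)) ⟩
  (p + k) C k + 1                              ∎)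
  where
    open ≡-Reasoning
    Tk : List Bool
    Tk = replicate k true ++ []
    |Tk| : length Tk ≡ k
    |Tk| = trans (length-expand ((true , k) ∷ [])) (+-identityʳ k)

lexRank-false-head-pos : ∀ k bs → k ≤ length bs → 0 < lexRank (suc k) (false ∷ bs)
lexRank-false-head-pos k bs k≤ = ≤-trans (C-pos (length bs) k k≤) (m≤m+n (length bs C k) (lexRank (suc k) bs))

Lcount-after-true-run : ∀ {n} k X {q} rs → WithinSeg 1 n X → RunsOf (χ X) 1 ((true , q) ∷ rs) →
  q + total rs ≡ n → Lcount n (q + k) X ≡ lexRank k (expand rs)
Lcount-after-true-run {n} k X {q} rs inX X-runs q+N≡n =
  trans (Lcount-runs n (q + k) X _ inX q+N≡n X-runs) (lexRank-true-run q k (expand rs))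

lexRank-two-blocks : ∀ q u v r →
  lexRank (u + r) (expand ((false , q) ∷ (true , u) ∷ (false , v) ∷ (true , r) ∷ [])) + (u + (v + r)) C (u + r)
    ≡ (q + (u + (v + r))) C (u + r) + (v + r) C r
lexRank-two-blocks q u v r = begin
  lexRank (u + r) (replicate q false ++ expand rs) + (u + (v + r)) C (u + r)
    ≡⟨ lexRank-false-run q (u + r) (expand rs) |rs| ⟩
  B + lexRank (u + r) (expand rs)  ≡⟨ cong (B +_) (lexRank-true-run u r (expand rs′)) ⟩
  B + lexRank r (expand rs′)       ≡⟨ cong (B +_) (lexRank-last v r) ⟩
  B + (v + r) C r                  ∎
  where
    open ≡-Reasoning
    B : ℕ
    B = (q + (u + (v + r))) C (u + r)
    rs′ rs : Runs
    rs′ = (false , v) ∷ (true , r) ∷ []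
    rs = (true , u) ∷ rs′
    |rs| : length (expand rs) ≡ u + (v + r)
    |rs| = trans (length-expand rs) (cong (λ x → u + (v + x)) (+-identityʳ r))

-- Pascal's rule absorbs the single point.
lexRank-point-block : ∀ q v r →
  lexRank (suc r) (expand ((false , q) ∷ (true , 1) ∷ (false , v) ∷ (true , r) ∷ [])) + (v + r) C suc r
    ≡ (q + suc (v + r)) C suc r
lexRank-point-block q v r = +-cancelʳ-≡ ((v + r) C r) _ _ (begin
  L + (v + r) C suc r + (v + r) C r                 ≡⟨ +-assoc L _ _ ⟩
  L + ((v + r) C suc r + (v + r) C r)               ≡⟨ cong (L +_) (trans (+-comm _ ((v + r) C r)) (pascal (v + r) r)) ⟩
  L + suc (v + r) C suc r                           ≡⟨ lexRank-two-blocks q 1 v r ⟩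
  (q + suc (v + r)) C suc r + (v + r) C r           ∎)
  where
    open ≡-Reasoning
    L : ℕ
    L = lexRank (suc r) (expand ((false , q) ∷ (true , 1) ∷ (false , v) ∷ (true , r) ∷ []))

Lcount-two-blocks : ∀ {n} X q u v r → WithinSeg 1 n X →
  RunsOf (χ X) 1 ((false , q) ∷ (true , u) ∷ (false , v) ∷ (true , r) ∷ []) → q + (u + (v + r)) ≡ n →
  Lcount n (u + r) X + (u + (v + r)) C (u + r) ≡ n C (u + r) + (v + r) C r
Lcount-two-blocks X q u v r inX X-runs refl =
  trans (cong (_+ _) (Lcount-runs _ (u + r) X _ inX total≡ X-runs)) (lexRank-two-blocks q u v r)
  where total≡ : q + (u + (v + (r + 0))) ≡ q + (u + (v + r))
        total≡ = cong (λ x → q + (u + (v + x))) (+-identityʳ r)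

Lcount-point-block : ∀ {n} X q v r → WithinSeg 1 n X →
  RunsOf (χ X) 1 ((false , q) ∷ (true , 1) ∷ (false , v) ∷ (true , r) ∷ []) → q + suc (v + r) ≡ n →
  Lcount n (suc r) X + (v + r) C suc r ≡ n C suc r
Lcount-point-block X q v r inX X-runs refl =
  trans (cong (_+ _) (Lcount-runs _ (suc r) X _ inX total≡ X-runs)) (lexRank-point-block q v r)
  where total≡ : q + (1 + (v + (r + 0))) ≡ q + suc (v + r)
        total≡ = cong (λ x → q + suc (v + x)) (+-identityʳ r)

∈ᵇ-range⁻ : ∀ p q y → y ∈ᵇ range p q → p ≤ y × y ≤ q
∈ᵇ-range⁻ p q y y∈ with ∈ᵇ-seg⁻ p (suc q ∸ p) y (subst (y ∈ᵇ_) (range≡seg p q) y∈)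
... | p≤y , y< with p ≤? suc q
...   | yes p≤q+1 = p≤y , ≤-pred (subst (y <_) (m+[n∸m]≡n p≤q+1) y<)
...   | no  p≰q+1 = ⊥-elim (<⇒≱ (subst (y <_) (trans (cong (p +_) (m≤n⇒m∸n≡0 (<⇒≤ (≰⇒> p≰q+1)))) (+-identityʳ p)) y<) p≤y)

∈ᵇ-range⁺ : ∀ p q y → p ≤ y → y ≤ q → y ∈ᵇ range p q
∈ᵇ-range⁺ p q y p≤y y≤q = subst (y ∈ᵇ_) (sym (range≡seg p q))
  (∈ᵇ-seg⁺ p (suc q ∸ p) y p≤y (subst (y <_) (sym (m+[n∸m]≡n (≤-trans p≤y (≤-trans y≤q (n≤1+n q))))) (s≤s y≤q)))

∉ᵇ-range : ∀ p q y → y < p ⊎ q < y → memᵇ y (range p q) ≡ false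
∉ᵇ-range p q y out with memᵇ y (range p q) in y∈
... | false = refl
... | true with ∈ᵇ-range⁻ p q y y∈ | out
...   | p≤y , _ | inj₁ y<p = ⊥-elim (<⇒≱ y<p p≤y)
...   | _ , y≤q | inj₂ q<y = ⊥-elim (<⇒≱ q<y y≤q)

WithinSeg-range : ∀ n p q → 1 ≤ p → q ≤ n → WithinSeg 1 n (range p q)
WithinSeg-range n p q 1≤p q≤n y y∈ with ∈ᵇ-range⁻ p q y y∈
... | p≤y , y≤q = ≤-trans 1≤p p≤y , s≤s (≤-trans y≤q q≤n)

WithinSeg-++ : ∀ n A B → WithinSeg 1 n A → WithinSeg 1 n B → WithinSeg 1 n (A ++ B)
WithinSeg-++ n A B inA inB y y∈ with ∨-≡true⁻ {memᵇ y A} (trans (sym (memᵇ-++ y A B)) y∈)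
... | inj₁ y∈A = inA y y∈A
... | inj₂ y∈B = inB y y∈B

WithinSeg-∷ : ∀ n x B → 1 ≤ x → x ≤ n → WithinSeg 1 n B → WithinSeg 1 n (x ∷ B)
WithinSeg-∷ n x B 1≤x x≤n inB y y∈ with ∈ᵇ-∷⁻ x y B y∈
... | inj₁ refl = 1≤x , s≤s x≤n
... | inj₂ y∈B  = inB y y∈B

foldl-⊔ : ∀ a L → foldl _⊔_ a L ≡ a ⊔ maxL L
foldl-⊔ a []      = sym (⊔-identityʳ a)
foldl-⊔ a (x ∷ L) = trans (foldl-⊔ (a ⊔ x) L) (trans (⊔-assoc a x (maxL L)) (cong (a ⊔_) (sym (foldl-⊔ x L))))

maxL-ub : ∀ L y → y ∈ᵇ L → y ≤ maxL L
maxL-ub (x ∷ L) y y∈ rewrite foldl-⊔ x L with ∈ᵇ-∷⁻ x y L y∈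
... | inj₁ refl = m≤m⊔n x (maxL L)
... | inj₂ y∈L  = ≤-trans (maxL-ub L y y∈L) (m≤n⊔m x (maxL L))

maxL-lub : ∀ L m → (∀ y → y ∈ᵇ L → y ≤ m) → maxL L ≤ m
maxL-lub []      m _   = z≤n
maxL-lub (x ∷ L) m L≤m rewrite foldl-⊔ x L =
  ⊔-lub (L≤m x (∈ᵇ-here x L)) (maxL-lub L m λ y y∈ → L≤m y (∈ᵇ-there x y L y∈))

maxL-≡ : ∀ L m → (∀ y → y ∈ᵇ L → y ≤ m) → m ∈ᵇ L → maxL L ≡ m
maxL-≡ L m L≤m m∈ = ≤-antisym (maxL-lub L m L≤m) (maxL-ub L m m∈)

ellFrom-tail : ∀ F f m y → m ∸ ellFrom F f m < y → y ≤ m → y ∈ᵇ F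
ellFrom-tail F zero    m       y m-ℓ<y y≤m = ⊥-elim (<⇒≱ m-ℓ<y y≤m)
ellFrom-tail F (suc f) zero    y m-ℓ<y y≤m = ⊥-elim (<⇒≱ m-ℓ<y y≤m)
ellFrom-tail F (suc f) (suc m) y m-ℓ<y y≤m with memᵇ (suc m) F in m+1∈F
... | false = ⊥-elim (<⇒≱ m-ℓ<y y≤m)
... | true with m≤n⇒m<n∨m≡n y≤m
...   | inj₂ refl = m+1∈F
...   | inj₁ y≤m′ = ellFrom-tail F f m y m-ℓ<y (≤-pred y≤m′)

ellFrom-exact : ∀ e d f F → (∀ y → suc d ≤ y → y ≤ d + e → y ∈ᵇ F) → (d ≡ 0 ⊎ memᵇ d F ≡ false) → d + e ≤ f →
  ellFrom F f (d + e) ≡ e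
ellFrom-exact zero d f F _ d-out d≤f rewrite +-identityʳ d with d | d-out | f | d≤f
... | zero   | _          | zero   | _ = refl
... | zero   | _          | suc f′ | _ = refl
... | suc d′ | inj₂ d∉F   | suc f′ | _ rewrite d∉F = refl
ellFrom-exact (suc e) d f F run d-out d+e<f rewrite +-suc d e with f | d+e<f
... | suc f′ | s≤s d+e≤f′ rewrite run (suc (d + e)) (s≤s (m≤m+n d e)) ≤-refl =
  cong suc (ellFrom-exact e d f′ F (λ y d<y y≤ → run y d<y (≤-trans y≤ (n≤1+n (d + e)))) d-out d+e≤f′)

ell-≡ : ∀ n G d e → d + e ≡ n → (∀ y → d < y → y ≤ n → y ∈ᵇ G) → (d ≡ 0 ⊎ memᵇ d G ≡ false) → ell n G ≡ e
ell-≡ .(d + e) G d e refl top d-out = ellFrom-exact e d (d + e) G top d-out ≤-refl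

memᵇ-parity : ∀ n h₁ h₂ G X → IsParity n h₁ h₂ G X → ∀ y →
  memᵇ y X ≡ ((memᵇ y G ∧ not (memᵇ y (tailSet n G))) ∨ memᵇ y (range (suc (n ∸ (ell n G + (h₂ ∸ h₁)))) n))
memᵇ-parity n h₁ h₂ G X (_ , _ , same , ℓX) y = ≡true⇔⇒≡ ∈X⇒ ⇒∈X
  where
    RHS : Bool
    RHS = (memᵇ y G ∧ not (memᵇ y (tailSet n G))) ∨ memᵇ y (range (suc (n ∸ (ell n G + (h₂ ∸ h₁)))) n)
    tailX : tailSet n X ≡ range (suc (n ∸ (ell n G + (h₂ ∸ h₁)))) n
    tailX = cong (λ e → range (suc (n ∸ e)) n) ℓX
    ∈X⇒ : y ∈ᵇ X → RHS ≡ true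
    ∈X⇒ y∈X with memᵇ y (tailSet n X) in y∈tX
    ... | true  = trans (cong ((memᵇ y G ∧ not (memᵇ y (tailSet n G))) ∨_) (subst (y ∈ᵇ_) tailX y∈tX)) (∨-zeroʳ _)
    ... | false with ∈ᵇ-diff⁻ y G (tailSet n G)
                       (∈⇒∈ᵇ y _ (proj₂ (same y) (∈ᵇ⇒∈ y _ (∈ᵇ-diff⁺ y X (tailSet n X) y∈X y∈tX))))
    ...   | y∈G , y∉tG rewrite y∈G | y∉tG = refl
    ⇒∈X : RHS ≡ true → y ∈ᵇ X
    ⇒∈X y∈ with ∨-≡true⁻ y∈
    ... | inj₁ y∈G∖tG with ∧-≡true⁻ {memᵇ y G} y∈G∖tG
    ...   | y∈G , y∉tG = proj₁ (∈ᵇ-diff⁻ y X (tailSet n X)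
                           (∈⇒∈ᵇ y _ (proj₁ (same y) (∈ᵇ⇒∈ y _ (∈ᵇ-diff⁺ y G (tailSet n G) y∈G (not-true y∉tG))))))
      where not-true : ∀ {b} → not b ≡ true → b ≡ false
            not-true {false} _ = refl
    ⇒∈X y∈ | inj₂ y∈tX with ∈ᵇ-range⁻ _ n y (subst (y ∈ᵇ_) (sym tailX) y∈tX)
    ... | n-ℓ<y , y≤n = ellFrom-tail X n n y n-ℓ<y y≤n

module _ {n h₁ h₂ G X e} (X-parity : IsParity n h₁ h₂ G X) (ℓG : ell n G ≡ e) where

  parity-low : ∀ y → y ≤ n ∸ (e + (h₂ ∸ h₁)) → memᵇ y X ≡ memᵇ y G
  parity-low y y≤ rewrite memᵇ-parity n h₁ h₂ G X X-parity y | ℓG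
    | ∉ᵇ-range (suc (n ∸ e)) n y (inj₁ (s≤s (≤-trans y≤ (∸-monoʳ-≤ n (m≤m+n e (h₂ ∸ h₁))))))
    | ∉ᵇ-range (suc (n ∸ (e + (h₂ ∸ h₁)))) n y (inj₁ (s≤s y≤))
    = trans (∨-identityʳ _) (∧-identityʳ _)

  parity-high : ∀ y → n ∸ (e + (h₂ ∸ h₁)) < y → y ≤ n → y ∈ᵇ X
  parity-high y <y y≤n rewrite memᵇ-parity n h₁ h₂ G X X-parity y | ℓG
    | ∈ᵇ-range⁺ (suc (n ∸ (e + (h₂ ∸ h₁)))) n y <y y≤n = ∨-zeroʳ _

partner-≡ : ∀ G q → maxL G ≡ q → partner G ≡ filterᵇ (λ x → not (memᵇ x G) ∨ (x ≡ᵇ q)) (range 1 q)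
partner-≡ G q refl = refl

memᵇ-partner : ∀ G q y → maxL G ≡ q → memᵇ y (partner G) ≡ (memᵇ y (range 1 q) ∧ (not (memᵇ y G) ∨ (y ≡ᵇ q)))
memᵇ-partner G q y maxG rewrite partner-≡ G q maxG = memᵇ-filterᵇ (λ x → not (memᵇ x G) ∨ (x ≡ᵇ q)) y (range 1 q)

partner-below : ∀ G q y → maxL G ≡ q → 1 ≤ y → y < q → memᵇ y (partner G) ≡ not (memᵇ y G)
partner-below G q y maxG 1≤y y<q rewrite memᵇ-partner G q y maxG | ∈ᵇ-range⁺ 1 q y 1≤y (<⇒≤ y<q)
  | ≢⇒≡ᵇ-false {y} {q} (<⇒≢ y<q) = ∨-identityʳ _

partner-max : ∀ G q → maxL G ≡ q → 1 ≤ q → q ∈ᵇ partner G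
partner-max G q maxG 1≤q rewrite memᵇ-partner G q q maxG | ∈ᵇ-range⁺ 1 q q 1≤q ≤-refl | ≡ᵇ-refl q = ∨-zeroʳ _

WithinSeg-partner : ∀ G q n → maxL G ≡ q → q ≤ n → WithinSeg 1 n (partner G)
WithinSeg-partner G q n maxG q≤n y y∈
  with ∈ᵇ-range⁻ 1 q y (proj₁ (∧-≡true⁻ {memᵇ y (range 1 q)} (trans (sym (memᵇ-partner G q y maxG)) y∈)))
... | 1≤y , y≤q = 1≤y , s≤s (≤-trans y≤q q≤n)

trueTotal : Runs → ℕ
trueTotal []                 = 0
trueTotal ((true  , l) ∷ rs) = l + trueTotal rs
trueTotal ((false , l) ∷ rs) = trueTotal rs

length-filterᵇ-id-expand : ∀ rs → length (filterᵇ (λ b → b) (expand rs)) ≡ trueTotal rs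
length-filterᵇ-id-expand []                    = refl
length-filterᵇ-id-expand ((true  , zero)  ∷ rs) = length-filterᵇ-id-expand rs
length-filterᵇ-id-expand ((false , zero)  ∷ rs) = length-filterᵇ-id-expand rs
length-filterᵇ-id-expand ((true  , suc l) ∷ rs) = cong suc (length-filterᵇ-id-expand ((true , l) ∷ rs))
length-filterᵇ-id-expand ((false , suc l) ∷ rs) = length-filterᵇ-id-expand ((false , l) ∷ rs)

length-partner : ∀ G q rs → maxL G ≡ q → total rs ≡ q → RunsOf (χ (partner G)) 1 rs → length (partner G) ≡ trueTotal rs
length-partner G .(total rs) rs maxG refl H-runs = begin
  length (partner G)                        ≡⟨ cong length (partner-≡ G q maxG) ⟩
  length (filterᵇ p (range 1 q))            ≡⟨ cong (λ L → length (filterᵇ p L)) (range≡seg 1 q) ⟩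
  length (filterᵇ p (seg 1 q))              ≡⟨ length-filterᵇ-map (λ b → b) p (seg 1 q) ⟨
  length (filterᵇ (λ b → b) (map p (seg 1 q))) ≡⟨ cong (λ bs → length (filterᵇ (λ b → b) bs)) (map-seg-runs p 1 rs p-runs) ⟩
  length (filterᵇ (λ b → b) (expand rs))    ≡⟨ length-filterᵇ-id-expand rs ⟩
  trueTotal rs                              ∎
  where
    open ≡-Reasoning
    q : ℕ
    q = total rs
    p : ℕ → Bool
    p x = not (memᵇ x G) ∨ (x ≡ᵇ q)
    p-runs : RunsOf p 1 rs
    p-runs = RunsOf-cong (χ (partner G)) p 1 rs
      (λ y 1≤y y< → sym (trans (memᵇ-partner G q y maxG) (cong (_∧ p y) (∈ᵇ-range⁺ 1 q y 1≤y (≤-pred y<))))) H-runs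

kPartner-unfold : ∀ n k F → kPartner n k F ≡
  (if k ≡ᵇ length (partner F) then partner F
   else (if length (partner F) <ᵇ k then partner F ++ range (suc (n ∸ k + length (partner F))) n
         else lexLast (filterᵇ (λ K → lexᵇ K (partner F)) (kSubsets n k))))
kPartner-unfold n k F with partner F
... | H with k ≡ᵇ length H | length H <ᵇ k
...   | true  | _     = refl
...   | false | true  = refl
...   | false | false = refl

-- For k = h the padding range is empty, so both cases k ≥ h take this form.
kPartner-pad : ∀ n k F → length (partner F) ≤ k → kPartner n k F ≡ partner F ++ range (suc (n ∸ k + length (partner F))) n
kPartner-pad n k F h≤k with m≤n⇒m<n∨m≡n h≤k
... | inj₁ h<k rewrite kPartner-unfold n k F | ≢⇒≡ᵇ-false {k} {length (partner F)} (>⇒≢ h<k) | <⇒<ᵇ-true h<k = refl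
... | inj₂ refl rewrite kPartner-unfold n (length (partner F)) F | ≡ᵇ-refl (length (partner F)) =
  sym (trans (cong (partner F ++_) empty) (++-identityʳ (partner F)))
  where
    h : ℕ
    h = length (partner F)
    n≤ : n ≤ n ∸ h + h
    n≤ with h ≤? n
    ... | yes h≤n = ≤-reflexive (sym (m∸n+n≡m h≤n))
    ... | no  h≰n = ≤-trans (<⇒≤ (≰⇒> h≰n)) (m≤n+m h (n ∸ h))
    empty : range (suc (n ∸ h + h)) n ≡ []
    empty = trans (range≡seg (suc (n ∸ h + h)) n) (cong (seg (suc (n ∸ h + h))) (m≤n⇒m∸n≡0 n≤))

kPartner-lexLast : ∀ n k F → k < length (partner F) →
  kPartner n k F ≡ lexLast (filterᵇ (λ K → lexᵇ K (partner F)) (kSubsets n k))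
kPartner-lexLast n k F k<h
  rewrite kPartner-unfold n k F | ≢⇒≡ᵇ-false {k} {length (partner F)} (<⇒≢ k<h) | ≥⇒<ᵇ-false (<⇒≤ k<h) = refl

partner-above : ∀ G q y → maxL G ≡ q → q < y → memᵇ y (partner G) ≡ false
partner-above G q y maxG q<y rewrite memᵇ-partner G q y maxG | ∉ᵇ-range 1 q y (inj₂ q<y) = refl

-- Binomial coefficients and the final inequality

C-absorption : ∀ m c → suc c * (m C suc c) + c * (m C c) ≡ m * (m C c)
C-absorption zero    zero    = refl
C-absorption zero    (suc c) rewrite *-zeroʳ c = refl
C-absorption (suc m) zero    =
  trans (+-identityʳ _) (trans (*-identityˡ _) (trans (nC1≡n (suc m)) (sym (*-identityʳ (suc m)))))
C-absorption (suc m) (suc c) = begin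
  suc (suc c) * (suc m C suc (suc c)) + suc c * (suc m C suc c)
    ≡⟨ cong₂ (λ u v → suc (suc c) * u + suc c * v) (pascal m (suc c)) (pascal m c) ⟨
  suc (suc c) * (Y + W) + suc c * (X + Y)
    ≡⟨ solve 4 (λ c X Y W → (con 2 :+ c) :* (Y :+ W) :+ (con 1 :+ c) :* (X :+ Y)
                          := ((con 2 :+ c) :* W :+ (con 1 :+ c) :* Y) :+ Y :+ ((con 1 :+ c) :* Y :+ c :* X) :+ X)
                            refl c X Y W ⟩
  (suc (suc c) * W + suc c * Y) + Y + (suc c * Y + c * X) + X
    ≡⟨ cong₂ (λ u v → u + Y + v + X) (C-absorption m (suc c)) (C-absorption m c) ⟩
  m * Y + Y + m * X + X
    ≡⟨ solve 3 (λ m X Y → m :* Y :+ Y :+ m :* X :+ X := (con 1 :+ m) :* (X :+ Y)) refl m X Y ⟩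
  suc m * (X + Y)
    ≡⟨ cong (suc m *_) (pascal m c) ⟩
  suc m * (suc m C suc c) ∎
  where
    open ≡-Reasoning
    X Y W : ℕ
    X = m C c
    Y = m C suc c
    W = m C suc (suc c)

C-absorption-∸ : ∀ {m c} → c ≤ m → suc c * (m C suc c) ≡ (m ∸ c) * (m C c)
C-absorption-∸ {m} {c} c≤m = +-cancelʳ-≡ (c * (m C c)) _ _ (begin
  suc c * (m C suc c) + c * (m C c) ≡⟨ C-absorption m c ⟩
  m * (m C c)                       ≡⟨ cong (λ x → x * (m C c)) (m∸n+n≡m c≤m) ⟨
  (m ∸ c + c) * (m C c)             ≡⟨ *-distribʳ-+ (m C c) (m ∸ c) c ⟩
  (m ∸ c) * (m C c) + c * (m C c)   ∎)
  where open ≡-Reasoning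

module _ {M w j : ℕ} (M≡w+j : M ≡ w + j) where

  C-ratio-top : suc j * (M C suc j) ≡ w * (M C j)
  C-ratio-top = trans (C-absorption-∸ (subst (j ≤_) (sym M≡w+j) (m≤n+m j w)))
                      (cong (λ x → x * (M C j)) (trans (cong (_∸ j) M≡w+j) (m+n∸n≡m w j)))

  C-ratio-bound : ∀ b → suc b ≤ w → suc j * (M C b) ≤ w * (M C suc b)
  C-ratio-bound b b<w = *-cancelˡ-≤ (suc b) (begin
    suc b * (suc j * X)    ≡⟨ *-assoc (suc b) (suc j) X ⟨
    suc b * suc j * X      ≤⟨ *-monoˡ-≤ X (*-mono-≤ b<w j<M∸b) ⟩
    w * (M ∸ b) * X        ≡⟨ *-assoc w (M ∸ b) X ⟩
    w * ((M ∸ b) * X)      ≡⟨ cong (w *_) (C-absorption-∸ b≤M) ⟨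
    w * (suc b * Y)        ≡⟨ x∙yz≈y∙xz w (suc b) Y ⟩
    suc b * (w * Y)        ∎)
    where
      open ≤-Reasoning
      open import Algebra.Properties.CommutativeSemigroup *-commutativeSemigroup using (x∙yz≈y∙xz)
      X Y : ℕ
      X = M C b
      Y = M C suc b
      b≤M : b ≤ M
      b≤M = ≤-trans (n≤1+n b) (≤-trans b<w (subst (w ≤_) (sym M≡w+j) (m≤m+n w j)))
      j<M∸b : suc j ≤ M ∸ b
      j<M∸b = subst (suc j ≤_) (cong (_∸ b) (sym M≡w+j))
                (subst (_≤ w + j ∸ b) (trans (cong (_∸ b) (+-comm (suc b) j))
                                             (trans (cong (_∸ b) (+-suc j b)) (m+n∸n≡m (suc j) b)))
                  (∸-monoˡ-≤ b (+-monoˡ-≤ j b<w)))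

bounds-incompatible : ∀ {A B M P P⁻ w j} → M ≡ w + j → 1 ≤ j → suc j * B ≡ w * A → suc j * P⁻ ≤ w * P →
  P ≤ A + 1 → B + M ≤ P⁻ → ⊥
bounds-incompatible {A} {B} {M} {P} {P⁻} {w} {j} M≡w+j 1≤j top ratio P≤A+1 B+M≤P⁻ =
  <⇒≱ w<M′ (+-cancelˡ-≤ (suc j * B) _ _ chain)
  where
    open ≤-Reasoning
    chain : suc j * B + suc j * M ≤ suc j * B + w
    chain = begin
      suc j * B + suc j * M ≡⟨ *-distribˡ-+ (suc j) B M ⟨
      suc j * (B + M)       ≤⟨ *-monoʳ-≤ (suc j) B+M≤P⁻ ⟩
      suc j * P⁻            ≤⟨ ratio ⟩
      w * P                 ≤⟨ *-monoʳ-≤ w P≤A+1 ⟩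
      w * (A + 1)           ≡⟨ *-distribˡ-+ w A 1 ⟩
      w * A + w * 1         ≡⟨ cong₂ _+_ (sym top) (*-identityʳ w) ⟩
      suc j * B + w         ∎
    w<M′ : w < suc j * M
    w<M′ = begin-strict
      w      <⟨ ≤-refl ⟩
      suc w  ≤⟨ subst (suc w ≤_) (trans (+-comm j w) (sym M≡w+j)) (+-monoˡ-≤ w 1≤j) ⟩
      M      ≤⟨ m≤m+n M (j * M) ⟩
      suc j * M ∎

module _ {gD gE gF Z Y A B M TD TF S P P⁻ : ℕ}
         (gD≡ : gD + Z ≡ Y + A + 1 + TD) (TD+P≡S : TD + P ≡ S)
         (gE≡ : gE + Z ≡ Y + S)
         (gF≡ : gF + Z ≡ Y + (A + B) + suc M + TF) (TF+P⁻+P≡S : TF + (P⁻ + P) ≡ S) where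

  gE≤gD⇒ : gE ≤ gD → P ≤ A + 1
  gE≤gD⇒ gE≤gD = +-cancelˡ-≤ TD _ _ (+-cancelˡ-≤ Y _ _ (subst₂ _≤_
    (trans gE≡ (cong (Y +_) (sym TD+P≡S)))
    (trans gD≡ (solve 3 (λ Y A TD → Y :+ A :+ con 1 :+ TD := Y :+ (TD :+ (A :+ con 1))) refl Y A TD))
    (+-monoˡ-≤ Z gE≤gD)))

  gF≤gD⇒ : gF ≤ gD → B + M ≤ P⁻
  gF≤gD⇒ gF≤gD = +-cancelˡ-≤ (Y + A + 1 + S) _ _ (subst₂ _≤_
    (trans (cong (_+ (P⁻ + P)) gF≡)
      (trans (solve 7 (λ Y A B M TF P⁻ P → Y :+ (A :+ B) :+ (con 1 :+ M) :+ TF :+ (P⁻ :+ P)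
                                         := Y :+ A :+ con 1 :+ (TF :+ (P⁻ :+ P)) :+ (B :+ M)) refl Y A B M TF P⁻ P)
             (cong (λ x → Y + A + 1 + x + (B + M)) TF+P⁻+P≡S)))
    (trans (cong (_+ (P⁻ + P)) gD≡)
      (trans (solve 5 (λ Y A TD P⁻ P → Y :+ A :+ con 1 :+ TD :+ (P⁻ :+ P)
                                    := Y :+ A :+ con 1 :+ (TD :+ P) :+ P⁻) refl Y A TD P⁻ P)
             (cong (λ x → Y + A + 1 + x + P⁻) TD+P≡S)))
    (+-monoˡ-≤ (P⁻ + P) (+-monoˡ-≤ Z gF≤gD)))

  max-exceeds : ∀ {w j} → M ≡ w + j → 1 ≤ j → suc j * B ≡ w * A → suc j * P⁻ ≤ w * P → gD < gE ⊔ gF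
  max-exceeds M≡w+j 1≤j top ratio with gD <? gE | gD <? gF
  ... | yes gD<gE | _         = <-≤-trans gD<gE (m≤m⊔n gE gF)
  ... | no  _     | yes gD<gF = <-≤-trans gD<gF (m≤n⊔m gE gF)
  ... | no  gD≮gE | no gD≮gF  =
    ⊥-elim (bounds-incompatible M≡w+j 1≤j top ratio (gE≤gD⇒ (≮⇒≥ gD≮gE)) (gF≤gD⇒ (≮⇒≥ gD≮gF)))

module _ {A : Set} where

  sum-map-+ : ∀ (f h : A → ℕ) L → sum (map (λ i → f i + h i) L) ≡ sum (map f L) + sum (map h L)
  sum-map-+ f h []      = refl
  sum-map-+ f h (x ∷ L) rewrite sum-map-+ f h L =
    solve 4 (λ a b c d → (a :+ b) :+ (c :+ d) := (a :+ c) :+ (b :+ d)) refl (f x) (h x) (sum (map f L)) (sum (map h L))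

  sum-map-*ˡ : ∀ c (f : A → ℕ) L → sum (map (λ i → c * f i) L) ≡ c * sum (map f L)
  sum-map-*ˡ c f []      = sym (*-zeroʳ c)
  sum-map-*ˡ c f (x ∷ L) rewrite sum-map-*ˡ c f L = sym (*-distribˡ-+ c (f x) (sum (map f L)))

  sum-map-cong : ∀ (f h : A → ℕ) L → (∀ i → i ∈ L → f i ≡ h i) → sum (map f L) ≡ sum (map h L)
  sum-map-cong f h []      _   = refl
  sum-map-cong f h (x ∷ L) f≗h = cong₂ _+_ (f≗h x (here refl)) (sum-map-cong f h L λ i i∈ → f≗h i (there i∈))

  sum-map-mono : ∀ (f h : A → ℕ) L → (∀ i → i ∈ L → f i ≤ h i) → sum (map f L) ≤ sum (map h L)
  sum-map-mono f h []      _   = ≤-refl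
  sum-map-mono f h (x ∷ L) f≤h = +-mono-≤ (f≤h x (here refl)) (sum-map-mono f h L λ i i∈ → f≤h i (there i∈))

-- The sets of the theorem for first element s = a + 2, with k₂ = k = kk + 2, k₁ = K = k + j′ + 1
-- and n = (s - 1) + K + w; the sizes kᵢ (i ≥ 3) of the partners then lie in [s, s - 1 + w].
module Configuration (a kk j′ w : ℕ) where
  p s k j K M N₁ n : ℕ
  p = suc a
  s = suc p
  k = suc (suc kk)
  j = suc j′
  K = k + j
  M = w + j
  N₁ = k + M
  n = p + N₁

  GD GE GF : List ℕ
  GD = range s (s + k ∸ 1)
  GE = (s ∸ 1) ∷ range (n ∸ k + 2) n
  GF = range s (s + k ∸ 2) ++ (n ∷ [])

  p+k≤n : p + k ≤ n
  p+k≤n = +-monoʳ-≤ p (m≤m+n k M)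

  0<M : 0 < M
  0<M = subst (0 <_) (sym (+-suc w j′)) z<s

  p+k<n : p + k < n
  p+k<n = subst (p + k <_) (+-assoc p k M) (m<m+n (p + k) 0<M)

  GD-below : ∀ y → y ≤ p → memᵇ y GD ≡ false
  GD-below y y≤p = ∉ᵇ-range s (p + k) y (inj₁ (s≤s y≤p))

  GD-inside : ∀ y → p < y → y ≤ p + k → y ∈ᵇ GD
  GD-inside y p<y y≤ = ∈ᵇ-range⁺ s (p + k) y p<y y≤

  GD-above : ∀ y → p + k < y → memᵇ y GD ≡ false
  GD-above y <y = ∉ᵇ-range s (p + k) y (inj₂ <y)

  GD-runs : RunsOf (χ GD) 1 ((false , p) ∷ (true , k) ∷ (false , M) ∷ (true , 0) ∷ [])
  GD-runs = (λ y _ y≤p → GD-below y (≤-pred y≤p)) ,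
            (λ y p<y y< → GD-inside y p<y (≤-pred y<)) ,
            (λ y <y _ → GD-above y <y) ,
            empty-run (χ GD) true _ , tt

  GD-within : WithinSeg 1 n GD
  GD-within = WithinSeg-range n s (p + k) (s≤s z≤n) p+k≤n

  Lcount-GD : Lcount n k GD + N₁ C k ≡ n C k + 1
  Lcount-GD = begin
    Lcount n k GD + N₁ C k
      ≡⟨ cong₂ (λ x y → Lcount n x GD + (k + y) C x) (+-identityʳ k) (+-identityʳ M) ⟨
    Lcount n (k + 0) GD + (k + (M + 0)) C (k + 0)
      ≡⟨ Lcount-two-blocks GD p k M 0 GD-within GD-runs (cong (λ x → p + (k + x)) (+-identityʳ M)) ⟩
    n C (k + 0) + 1                                ≡⟨ cong (λ x → n C x + 1) (+-identityʳ k) ⟩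
    n C k + 1                                      ∎
    where open ≡-Reasoning

  ell-GD : ell n GD ≡ 0
  ell-GD = ell-≡ n GD n 0 (+-identityʳ n) (λ y n<y y≤n → ⊥-elim (<⇒≱ n<y y≤n)) (inj₂ (GD-above n p+k<n))

  n∸k≡ : n ∸ k ≡ p + M
  n∸k≡ = trans (cong (_∸ k) (solve 4 (λ a kk w j → con 1 :+ a :+ (con 2 :+ kk :+ (w :+ j))
                                                := con 1 :+ a :+ (w :+ j) :+ (con 2 :+ kk)) refl a kk w j))
               (m+n∸n≡m (p + M) k)

  topE : n ∸ k + 2 ≡ p + 1 + suc M
  topE = trans (cong (_+ 2) n∸k≡) (solve 2 (λ p M → p :+ M :+ con 2 := p :+ con 1 :+ (con 1 :+ M)) refl p M)

  endE : p + 1 + suc M + suc kk ≡ suc n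
  endE = solve 4 (λ a kk w j → con 1 :+ a :+ con 1 :+ (con 1 :+ (w :+ j)) :+ (con 1 :+ kk)
                            := con 1 :+ (con 1 :+ a :+ (con 2 :+ kk :+ (w :+ j)))) refl a kk w j

  p<top : p < n ∸ k + 2
  p<top = subst (p <_) (sym topE) (≤-trans (≤-reflexive (+-comm 1 p)) (m≤m+n (p + 1) (suc M)))

  GE-below : ∀ y → y < p → memᵇ y GE ≡ false
  GE-below y y<p rewrite ≢⇒≡ᵇ-false {y} {p} (<⇒≢ y<p) =
    ∉ᵇ-range (n ∸ k + 2) n y (inj₁ (<-trans y<p p<top))

  GE-gap : ∀ y → p < y → y < p + 1 + suc M → memᵇ y GE ≡ false
  GE-gap y p<y y< rewrite ≢⇒≡ᵇ-false {y} {p} (>⇒≢ p<y) = ∉ᵇ-range (n ∸ k + 2) n y (inj₁ (subst (y <_) (sym topE) y<))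

  GE-top : ∀ y → p + 1 + suc M ≤ y → y ≤ n → y ∈ᵇ GE
  GE-top y t≤y y≤n rewrite ∈ᵇ-range⁺ (n ∸ k + 2) n y (subst (_≤ y) (sym topE) t≤y) y≤n = ∨-zeroʳ _

  GE-runs : RunsOf (χ GE) 1 ((false , a) ∷ (true , 1) ∷ (false , suc M) ∷ (true , suc kk) ∷ [])
  GE-runs = (λ y _ y<p → GE-below y y<p) ,
            (λ y p≤y y<p+1 → subst (_∈ᵇ GE) (sym (≤-antisym (≤-pred (subst (y <_) (+-comm p 1) y<p+1)) p≤y))
                                              (∈ᵇ-here p (range (n ∸ k + 2) n))) ,
            (λ y p+1≤y y< → GE-gap y (subst (_≤ y) (+-comm p 1) p+1≤y) y<) ,
            (λ y t≤y y< → GE-top y t≤y (≤-pred (subst (y <_) endE y<))) , tt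

  GE-within : WithinSeg 1 n GE
  GE-within = WithinSeg-∷ n p (range (n ∸ k + 2) n) (s≤s z≤n) (≤-trans (m≤m+n p k) p+k≤n)
                (WithinSeg-range n (n ∸ k + 2) n (≤-trans (s≤s z≤n) p<top) ≤-refl)

  Lcount-GE : Lcount n k GE + N₁ C k ≡ n C k
  Lcount-GE = subst (λ N → Lcount n k GE + N C k ≡ n C k) N₁≡
                    (Lcount-point-block GE a (suc M) (suc kk) GE-within GE-runs
                                         (trans (+-suc a (suc M + suc kk)) (cong (λ x → suc (a + x)) N₁≡)))
    where
      N₁≡ : suc M + suc kk ≡ N₁
      N₁≡ = solve 2 (λ M kk → (con 1 :+ M) :+ (con 1 :+ kk) := con 2 :+ kk :+ M) refl M kk

  ell-GE : ell n GE ≡ suc kk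
  ell-GE = ell-≡ n GE (p + suc M) (suc kk) d+e≡n
    (λ y d<y y≤n → GE-top y (subst (_≤ y) (sym top≡) d<y) y≤n)
    (inj₂ (GE-gap (p + suc M) (m<m+n p z<s) (subst (p + suc M <_) (sym top≡) ≤-refl)))
    where
      top≡ : p + 1 + suc M ≡ suc (p + suc M)
      top≡ = solve 2 (λ p M → p :+ con 1 :+ (con 1 :+ M) := con 1 :+ (p :+ (con 1 :+ M))) refl p M
      d+e≡n : p + suc M + suc kk ≡ n
      d+e≡n = solve 4 (λ a kk w j → con 1 :+ a :+ (con 1 :+ (w :+ j)) :+ (con 1 :+ kk)
                                 := con 1 :+ a :+ (con 2 :+ kk :+ (w :+ j))) refl a kk w j

  p+suc-kk≡ : p + suc kk ≡ a + k
  p+suc-kk≡ = sym (+-suc a (suc kk))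

  nF≡ : suc (p + suc kk + M) ≡ n
  nF≡ = solve 4 (λ a kk w j → con 1 :+ (con 1 :+ a :+ (con 1 :+ kk) :+ (w :+ j))
                           := con 1 :+ a :+ (con 2 :+ kk :+ (w :+ j))) refl a kk w j

  p+suc-kk<n : p + suc kk < n
  p+suc-kk<n = ≤-trans (s≤s (m≤m+n (p + suc kk) M)) (≤-reflexive nF≡)

  memᵇ-GF : ∀ y → memᵇ y GF ≡ (memᵇ y (range s (a + k)) ∨ ((y ≡ᵇ n) ∨ false))
  memᵇ-GF y = memᵇ-++ y (range s (a + k)) (n ∷ [])

  GF-below : ∀ y → y ≤ p → memᵇ y GF ≡ false
  GF-below y y≤p rewrite memᵇ-GF y | ∉ᵇ-range s (a + k) y (inj₁ (s≤s y≤p))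
    | ≢⇒≡ᵇ-false {y} {n} (<⇒≢ (≤-<-trans y≤p (≤-<-trans (m≤m+n p k) p+k<n))) = refl

  GF-inside : ∀ y → p < y → y ≤ p + suc kk → y ∈ᵇ GF
  GF-inside y p<y y≤ rewrite memᵇ-GF y | ∈ᵇ-range⁺ s (a + k) y p<y (subst (y ≤_) p+suc-kk≡ y≤) = refl

  GF-gap : ∀ y → p + suc kk < y → y < n → memᵇ y GF ≡ false
  GF-gap y <y y<n rewrite memᵇ-GF y | ∉ᵇ-range s (a + k) y (inj₂ (subst (_< y) p+suc-kk≡ <y))
    | ≢⇒≡ᵇ-false {y} {n} (<⇒≢ y<n) = refl

  GF-n : n ∈ᵇ GF
  GF-n rewrite memᵇ-GF n | ∉ᵇ-range s (a + k) n (inj₂ (subst (_< n) p+suc-kk≡ p+suc-kk<n))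
    | ≡ᵇ-refl n = refl

  GF-runs : RunsOf (χ GF) 1 ((false , p) ∷ (true , suc kk) ∷ (false , M) ∷ (true , 1) ∷ [])
  GF-runs = (λ y _ y<1+p → GF-below y (≤-pred y<1+p)) ,
            (λ y p<y y< → GF-inside y p<y (≤-pred y<)) ,
            (λ y <y y< → GF-gap y <y (subst (y <_) nF≡ y<)) ,
            (λ y n≤y y< → subst (_∈ᵇ GF) (≤-antisym (subst (_≤ y) nF≡ n≤y) (≤-pred (subst (y <_) n+1≡ y<))) GF-n) , tt
    where
      n+1≡ : suc (p + suc kk + M) + 1 ≡ suc n
      n+1≡ = trans (+-comm _ 1) (cong suc nF≡)

  GF-within : WithinSeg 1 n GF
  GF-within = WithinSeg-++ n (range s (a + k)) (n ∷ [])
    (WithinSeg-range n s (a + k) (s≤s z≤n) (subst (_≤ n) p+suc-kk≡ (<⇒≤ p+suc-kk<n)))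
    (WithinSeg-∷ n n [] (≤-trans (s≤s z≤n) p+k≤n) ≤-refl λ _ ())

  ell-GF : ell n GF ≡ 1
  ell-GF = ell-≡ n GF (p + suc kk + M) 1 (trans (+-comm _ 1) nF≡)
    (λ y d<y y≤n → subst (_∈ᵇ GF) (≤-antisym (subst (_≤ y) nF≡ d<y) y≤n) GF-n)
    (inj₂ (GF-gap (p + suc kk + M) (m<m+n (p + suc kk) 0<M) (subst (p + suc kk + M <_) nF≡ ≤-refl)))

  Lcount-GF : Lcount n k GF + N₁ C k ≡ n C k + suc M
  Lcount-GF = begin
    Lcount n k GF + N₁ C k                                        ≡⟨ cong₂ (λ x N → Lcount n x GF + N C x) k≡ N₁≡ ⟨
    Lcount n (suc kk + 1) GF + (suc kk + (M + 1)) C (suc kk + 1)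
      ≡⟨ Lcount-two-blocks GF p (suc kk) M 1 GF-within GF-runs (cong (p +_) N₁≡) ⟩
    n C (suc kk + 1) + (M + 1) C 1
      ≡⟨ cong₂ (λ x y → n C x + y) k≡ (trans (nC1≡n (M + 1)) (+-comm M 1)) ⟩
    n C k + suc M                                                 ∎
    where
      open ≡-Reasoning
      k≡ : suc kk + 1 ≡ k
      k≡ = +-comm (suc kk) 1
      N₁≡ : suc kk + (M + 1) ≡ N₁
      N₁≡ = solve 2 (λ kk M → (con 1 :+ kk) :+ (M :+ con 1) := con 2 :+ kk :+ M) refl kk M

  K∸k≡j : K ∸ k ≡ j
  K∸k≡j = m+n∸m≡n k j

  module Parity {G X e} (X-parity : IsParity n k K G X) (ℓG : ell n G ≡ e) where

    low : ∀ y → y ≤ n ∸ (e + j) → memᵇ y X ≡ memᵇ y G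
    low y y≤ = parity-low X-parity ℓG y (subst (λ d → y ≤ n ∸ (e + d)) (sym K∸k≡j) y≤)

    high : ∀ y → n ∸ (e + j) < y → y ≤ n → y ∈ᵇ X
    high y <y = parity-high X-parity ℓG y (subst (λ d → n ∸ (e + d) < y) (sym K∸k≡j) <y)

    within : WithinSeg 1 n X
    within = kSubsets-within n K X (proj₁ (proj₂ X-parity))

  w≤M : w ≤ M
  w≤M = m≤m+n w j

  X-runs : ∀ X → IsParity n k K GD X → RunsOf (χ X) 1 ((false , p) ∷ (true , k) ∷ (false , w) ∷ (true , j) ∷ [])
  X-runs X X-parity =
    (λ y _ y< → trans (low′ y (≤-trans y< (s≤s (≤-trans (m≤m+n p k) (m≤m+n (p + k) w))))) (GD-below y (≤-pred y<))) ,
    (λ y p<y y< → trans (low′ y (≤-trans y< (s≤s (m≤m+n (p + k) w)))) (GD-inside y p<y (≤-pred y<))) ,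
    (λ y <y y< → trans (low′ y y<) (GD-above y <y)) ,
    (λ y <y y< → high y (subst (_< y) (sym n∸j≡) <y) (≤-pred (subst (y <_) end≡ y<))) , tt
    where
      open Parity X-parity ell-GD
      n≡ : n ≡ p + k + w + j
      n≡ = solve 4 (λ a kk w j → con 1 :+ a :+ (con 2 :+ kk :+ (w :+ j))
                              := con 1 :+ a :+ (con 2 :+ kk) :+ w :+ j) refl a kk w j
      n∸j≡ : n ∸ (0 + j) ≡ p + k + w
      n∸j≡ = trans (cong (_∸ j) n≡) (m+n∸n≡m (p + k + w) j)
      end≡ : suc (p + k + w) + j ≡ suc n
      end≡ = cong suc (sym n≡)
      low′ : ∀ y → y < suc (p + k + w) → memᵇ y X ≡ memᵇ y GD
      low′ y y< = low y (subst (y ≤_) (sym n∸j≡) (≤-pred y<))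

  Lcount-X : ∀ X → IsParity n k K GD X → Lcount n K X + N₁ C K ≡ n C K + M C j
  Lcount-X X X-parity = Lcount-two-blocks X p k w j (Parity.within X-parity ell-GD) (X-runs X X-parity) refl

  Y-runs : ∀ Y → IsParity n k K GE Y →
    RunsOf (χ Y) 1 ((false , a) ∷ (true , 1) ∷ (false , suc w) ∷ (true , suc kk + j) ∷ [])
  Y-runs Y Y-parity =
    (λ y _ y<p → trans (low′ y (≤-trans y<p (≤-trans (m≤m+n p 1) (m≤m+n (p + 1) (suc w))))) (GE-below y y<p)) ,
    (λ y p≤y y<p+1 → trans (low′ y (≤-trans y<p+1 (m≤m+n (p + 1) (suc w))))
                       (subst (_∈ᵇ GE) (sym (≤-antisym (≤-pred (subst (y <_) (+-comm p 1) y<p+1)) p≤y))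
                                       (∈ᵇ-here p (range (n ∸ k + 2) n)))) ,
    (λ y p+1≤y y< → trans (low′ y y<)
                       (GE-gap y (subst (_≤ y) (+-comm p 1) p+1≤y) (<-≤-trans y< (+-monoʳ-≤ (p + 1) (s≤s w≤M))))) ,
    (λ y t≤y y< → high y (subst (_< y) (sym n∸≡) (subst (_≤ y) (+-suc (p + 1) w) t≤y))
                         (≤-pred (subst (y <_) end≡ y<))) , tt
    where
      open Parity Y-parity ell-GE
      n≡ : n ≡ p + 1 + w + (suc kk + j)
      n≡ = solve 4 (λ a kk w j → con 1 :+ a :+ (con 2 :+ kk :+ (w :+ j))
                              := con 1 :+ a :+ con 1 :+ w :+ (con 1 :+ kk :+ j)) refl a kk w j
      n∸≡ : n ∸ (suc kk + j) ≡ p + 1 + w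
      n∸≡ = trans (cong (_∸ (suc kk + j)) n≡) (m+n∸n≡m (p + 1 + w) (suc kk + j))
      end≡ : p + 1 + suc w + (suc kk + j) ≡ suc n
      end≡ = trans (cong (_+ (suc kk + j)) (+-suc (p + 1) w)) (cong suc (sym n≡))
      low′ : ∀ y → y < p + 1 + suc w → memᵇ y Y ≡ memᵇ y GE
      low′ y y< = low y (subst (y ≤_) (sym n∸≡) (≤-pred (subst (y <_) (+-suc (p + 1) w) y<)))

  Lcount-Y : ∀ Y → IsParity n k K GE Y → Lcount n K Y + N₁ C K ≡ n C K
  Lcount-Y Y Y-parity = subst (λ N → Lcount n K Y + N C K ≡ n C K) N₁≡
    (Lcount-point-block Y a (suc w) (suc kk + j) (Parity.within Y-parity ell-GE) (Y-runs Y Y-parity)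
                        (trans (+-suc a (suc w + (suc kk + j))) (cong (λ x → suc (a + x)) N₁≡)))
    where
      N₁≡ : suc w + (suc kk + j) ≡ N₁
      N₁≡ = solve 3 (λ kk w j → (con 1 :+ w) :+ (con 1 :+ kk :+ j) := con 2 :+ kk :+ (w :+ j)) refl kk w j

  Z-runs : ∀ Z → IsParity n k K GF Z → RunsOf (χ Z) 1 ((false , p) ∷ (true , suc kk) ∷ (false , w) ∷ (true , suc j) ∷ [])
  Z-runs Z Z-parity =
    (λ y _ y< → trans (low′ y (≤-trans y< (s≤s (≤-trans (m≤m+n p (suc kk)) (m≤m+n (p + suc kk) w)))))
                      (GF-below y (≤-pred y<))) ,
    (λ y p<y y< → trans (low′ y (≤-trans y< (s≤s (m≤m+n (p + suc kk) w)))) (GF-inside y p<y (≤-pred y<))) ,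
    (λ y <y y< → trans (low′ y y<)
                   (GF-gap y <y (<-≤-trans y< (subst (suc (p + suc kk + w) ≤_) nF≡ (s≤s (+-monoʳ-≤ (p + suc kk) w≤M)))))) ,
    (λ y <y y< → high y (subst (_< y) (sym n∸≡) <y) (≤-pred (subst (y <_) end≡ y<))) , tt
    where
      open Parity Z-parity ell-GF
      n≡ : n ≡ p + suc kk + w + (1 + j)
      n≡ = solve 4 (λ a kk w j → con 1 :+ a :+ (con 2 :+ kk :+ (w :+ j))
                              := con 1 :+ a :+ (con 1 :+ kk) :+ w :+ (con 1 :+ j)) refl a kk w j
      n∸≡ : n ∸ (1 + j) ≡ p + suc kk + w
      n∸≡ = trans (cong (_∸ (1 + j)) n≡) (m+n∸n≡m (p + suc kk + w) (1 + j))
      end≡ : suc (p + suc kk + w) + suc j ≡ suc n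
      end≡ = cong suc (sym n≡)
      low′ : ∀ y → y < suc (p + suc kk + w) → memᵇ y Z ≡ memᵇ y GF
      low′ y y< = low y (subst (y ≤_) (sym n∸≡) (≤-pred y<))

  Lcount-Z : ∀ Z → IsParity n k K GF Z → Lcount n K Z + N₁ C K ≡ n C K + suc M C suc j
  Lcount-Z Z Z-parity = begin
    Lcount n K Z + N₁ C K
      ≡⟨ cong₂ (λ x N → Lcount n x Z + N C x) K≡ N₁≡ ⟨
    Lcount n (suc kk + suc j) Z + (suc kk + (w + suc j)) C (suc kk + suc j)
      ≡⟨ Lcount-two-blocks Z p (suc kk) w (suc j) (Parity.within Z-parity ell-GF) (Z-runs Z Z-parity) (cong (p +_) N₁≡) ⟩
    n C (suc kk + suc j) + (w + suc j) C suc j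
      ≡⟨ cong₂ (λ x m → n C x + m C suc j) K≡ (+-suc w j) ⟩
    n C K + suc M C suc j                                                   ∎
    where
      open ≡-Reasoning
      K≡ : suc kk + suc j ≡ K
      K≡ = cong suc (+-suc kk j)
      N₁≡ : suc kk + (w + suc j) ≡ N₁
      N₁≡ = solve 3 (λ kk w j → (con 1 :+ kk) :+ (w :+ (con 1 :+ j)) := con 2 :+ kk :+ (w :+ j)) refl kk w j

  maxL-GD : maxL GD ≡ p + k
  maxL-GD = maxL-≡ GD (p + k) (λ y y∈ → proj₂ (∈ᵇ-range⁻ s (p + k) y y∈)) (GD-inside (p + k) (m<m+n p z<s) ≤-refl)

  runsHD : Runs
  runsHD = (true , p) ∷ (false , suc kk) ∷ (true , 1) ∷ []

  HD-runs : RunsOf (χ (partner GD)) 1 runsHD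
  HD-runs =
    (λ y 1≤y y< → trans (partner-below GD (p + k) y maxL-GD 1≤y (≤-trans y< (m<m+n p z<s)))
                        (cong not (GD-below y (≤-pred y<)))) ,
    (λ y p<y y< → trans (partner-below GD (p + k) y maxL-GD (≤-trans (s≤s z≤n) p<y)
                                       (subst (y <_) (sym (+-suc p (suc kk))) y<))
                        (cong not (GD-inside y p<y (≤-trans (≤-pred y<) (+-monoʳ-≤ p (n≤1+n (suc kk))))))) ,
    (λ y ≤y y< → subst (_∈ᵇ partner GD)
                    (≤-antisym (subst (_≤ y) max≡ ≤y) (≤-pred (subst (y <_) max+1≡ y<)))
                   (partner-max GD (p + k) maxL-GD (s≤s z≤n))) , tt
    where
      max≡ : suc p + suc kk ≡ p + k
      max≡ = sym (+-suc p (suc kk))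
      max+1≡ : suc p + suc kk + 1 ≡ suc (p + k)
      max+1≡ = trans (+-comm (suc p + suc kk) 1) (cong suc max≡)

  totalHD : total runsHD ≡ p + k
  totalHD = solve 2 (λ p kk → p :+ ((con 1 :+ kk) :+ (con 1 :+ con 0)) := p :+ (con 2 :+ kk)) refl p kk

  length-HD : length (partner GD) ≡ s
  length-HD = trans (length-partner GD (p + k) runsHD maxL-GD totalHD HD-runs) (+-comm p 1)

  module PartnerD (b′ v : ℕ) (w≡ : w ≡ suc b′ + v) where
    kᵢ : ℕ
    kᵢ = p + suc b′
    R PD : List ℕ
    R = range (suc (n ∸ kᵢ + s)) n
    PD = kPartner n kᵢ GD

    PD≡ : PD ≡ partner GD ++ R
    PD≡ = trans (kPartner-pad n kᵢ GD (subst (_≤ kᵢ) (sym length-HD) (m<m+n p z<s)))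
                (cong (λ h → partner GD ++ range (suc (n ∸ kᵢ + h)) n) length-HD)

    n≡ : n ≡ kᵢ + (k + (v + j))
    n≡ = trans (cong (λ x → p + (k + (x + j))) w≡)
      (solve 5 (λ a kk b′ v j → con 1 :+ a :+ (con 2 :+ kk :+ (con 1 :+ b′ :+ v :+ j))
                             := con 1 :+ a :+ (con 1 :+ b′) :+ (con 2 :+ kk :+ (v :+ j))) refl a kk b′ v j)

    start≡ : suc (n ∸ kᵢ + s) ≡ suc (p + k) + suc (v + j)
    start≡ = trans (cong (λ x → suc (x ∸ kᵢ + s)) n≡) (trans (cong (λ x → suc (x + s)) (m+n∸m≡n kᵢ (k + (v + j))))
      (solve 4 (λ a kk v j → con 1 :+ (con 2 :+ kk :+ (v :+ j) :+ (con 2 :+ a))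
                          := con 1 :+ (con 1 :+ a :+ (con 2 :+ kk)) :+ (con 1 :+ (v :+ j))) refl a kk v j))

    end≡ : suc (p + k) + suc (v + j) + b′ ≡ suc n
    end≡ = trans
      (solve 5 (λ a kk b′ v j → con 1 :+ (con 1 :+ a :+ (con 2 :+ kk)) :+ (con 1 :+ (v :+ j)) :+ b′
                             := con 1 :+ (con 1 :+ a :+ (con 1 :+ b′) :+ (con 2 :+ kk :+ (v :+ j)))) refl a kk b′ v j)
      (cong suc (sym n≡))

    runsPD : Runs
    runsPD = runsHD ++ ((false , suc (v + j)) ∷ (true , b′) ∷ [])

    memᵇ-PD : ∀ y → memᵇ y PD ≡ (memᵇ y (partner GD) ∨ memᵇ y R)
    memᵇ-PD y rewrite PD≡ = memᵇ-++ y (partner GD) R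

    PD-runs : RunsOf (χ PD) 1 runsPD
    PD-runs = RunsOf-++ (χ PD) 1 runsHD _ (RunsOf-cong (χ (partner GD)) (χ PD) 1 runsHD low HD-runs)
      (subst (λ c → RunsOf (χ PD) c ((false , suc (v + j)) ∷ (true , b′) ∷ [])) (cong suc (sym totalHD)) (gap , top , tt))
      where
        R-low : ∀ y → y < suc (p + k) + suc (v + j) → memᵇ y R ≡ false
        R-low y y< = ∉ᵇ-range (suc (n ∸ kᵢ + s)) n y (inj₁ (subst (y <_) (sym start≡) y<))
        low : ∀ y → 1 ≤ y → y < 1 + total runsHD → memᵇ y PD ≡ memᵇ y (partner GD)
        low y _ y< rewrite memᵇ-PD y
          | R-low y (≤-trans (subst (y <_) (cong suc totalHD) y<) (m≤m+n (suc (p + k)) (suc (v + j)))) = ∨-identityʳ _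
        gap : ∀ y → suc (p + k) ≤ y → y < suc (p + k) + suc (v + j) → memᵇ y PD ≡ false
        gap y <y y< rewrite memᵇ-PD y | partner-above GD (p + k) y maxL-GD <y | R-low y y< = refl
        top : ∀ y → suc (p + k) + suc (v + j) ≤ y → y < suc (p + k) + suc (v + j) + b′ → y ∈ᵇ PD
        top y ≤y y< rewrite memᵇ-PD y
          | ∈ᵇ-range⁺ (suc (n ∸ kᵢ + s)) n y (subst (_≤ y) (sym start≡) ≤y) (≤-pred (subst (y <_) end≡ y<)) = ∨-zeroʳ _

    PD-within : WithinSeg 1 n PD
    PD-within = subst (WithinSeg 1 n) (sym PD≡) (WithinSeg-++ n (partner GD) R
                  (WithinSeg-partner GD (p + k) n maxL-GD p+k≤n)
                  (WithinSeg-range n (suc (n ∸ kᵢ + s)) n (s≤s z≤n) ≤-refl))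

    Lcount-PD : Lcount n kᵢ PD + M C suc b′ ≡ N₁ C suc b′
    Lcount-PD = begin
      Lcount n kᵢ PD + M C suc b′
        ≡⟨ cong₂ _+_ (Lcount-after-true-run (suc b′) PD rest PD-within PD-runs total≡)
                                                                                (cong (_C suc b′) (sym M≡)) ⟩
      lexRank (suc b′) (expand rest) + (suc (v + j) + b′) C suc b′ ≡⟨ lexRank-point-block (suc kk) (suc (v + j)) b′ ⟩
      (suc kk + suc (suc (v + j) + b′)) C suc b′                   ≡⟨ cong (λ m → (suc kk + suc m) C suc b′) M≡ ⟩
      (suc kk + suc M) C suc b′                                    ≡⟨ cong (_C suc b′) (+-suc (suc kk) M) ⟩
      N₁ C suc b′                                                  ∎
      where
        open ≡-Reasoning
        rest : Runs
        rest = (false , suc kk) ∷ (true , 1) ∷ (false , suc (v + j)) ∷ (true , b′) ∷ []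
        M≡ : suc (v + j) + b′ ≡ M
        M≡ = trans (solve 3 (λ b′ v j → con 1 :+ (v :+ j) :+ b′ := con 1 :+ b′ :+ v :+ j) refl b′ v j)
                   (cong (_+ j) (sym w≡))
        total≡ : p + total rest ≡ n
        total≡ = trans
          (solve 5 (λ a kk b′ v j → (con 1 :+ a) :+ ((con 1 :+ kk) :+ (con 1 :+ ((con 1 :+ (v :+ j)) :+ (b′ :+ con 0))))
                                 := con 1 :+ a :+ (con 1 :+ b′) :+ (con 2 :+ kk :+ (v :+ j))) refl a kk b′ v j)
          (sym n≡)

  endE′ : p + 1 + suc M + kk ≡ n
  endE′ = suc-injective (trans (sym (+-suc (p + 1 + suc M) kk)) endE)

  maxL-GE : maxL GE ≡ n
  maxL-GE = maxL-≡ GE n (λ y y∈ → ≤-pred (proj₂ (GE-within y y∈)))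
                      (GE-top n (subst (p + 1 + suc M ≤_) endE′ (m≤m+n _ kk)) ≤-refl)

  runsHE : Runs
  runsHE = (true , a) ∷ (false , 1) ∷ (true , suc M) ∷ (false , kk) ∷ (true , 1) ∷ []

  p<n : p < n
  p<n = <-≤-trans (m<m+n p z<s) p+k≤n

  HE-runs : RunsOf (χ (partner GE)) 1 runsHE
  HE-runs =
    (λ y 1≤y y<p → trans (below y 1≤y (<-trans y<p p<n)) (cong not (GE-below y y<p))) ,
    (λ y p≤y y<p+1 → let y≡p = ≤-antisym (≤-pred (subst (y <_) (+-comm p 1) y<p+1)) p≤y in
                     trans (below y (≤-trans (s≤s z≤n) p≤y) (subst (_< n) (sym y≡p) p<n))
                           (cong not (subst (_∈ᵇ GE) (sym y≡p) (∈ᵇ-here p (range (n ∸ k + 2) n))))) ,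
    (λ y p+1≤y y< → trans (below y (≤-trans (s≤s z≤n) p+1≤y) (<-≤-trans y< (subst (p + 1 + suc M ≤_) endE′ (m≤m+n _ kk))))
                          (cong not (GE-gap y (subst (_≤ y) (+-comm p 1) p+1≤y) y<))) ,
    (λ y ≤y y< → trans (below y (≤-trans (s≤s z≤n) (≤-trans (m≤m+n (p + 1) (suc M)) ≤y)) (subst (y <_) endE′ y<))
                       (cong not (GE-top y ≤y (<⇒≤ (subst (y <_) endE′ y<))))) ,
    (λ y ≤y y< → subst (_∈ᵇ partner GE)
                    (≤-antisym (subst (_≤ y) endE′ ≤y) (≤-pred (subst (y <_) (trans (+-comm _ 1) (cong suc endE′)) y<)))
                   (partner-max GE n maxL-GE (≤-trans (s≤s z≤n) p<n))) , tt
    where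
      below : ∀ y → 1 ≤ y → y < n → memᵇ y (partner GE) ≡ not (memᵇ y GE)
      below y = partner-below GE n y maxL-GE

  totalHE : total runsHE ≡ n
  totalHE = solve 4 (λ a kk w j → a :+ (con 1 :+ ((con 1 :+ (w :+ j)) :+ (kk :+ (con 1 :+ con 0))))
                               := con 1 :+ a :+ (con 2 :+ kk :+ (w :+ j))) refl a kk w j

  length-HE : length (partner GE) ≡ a + (suc M + 1)
  length-HE = length-partner GE n runsHE maxL-GE totalHE HE-runs

  HE-within : WithinSeg 1 n (partner GE)
  HE-within = WithinSeg-partner GE n n maxL-GE ≤-refl

  w<M : w < M
  w<M = subst (w <_) (sym (+-suc w j′)) (s≤s (m≤m+n w j′))

  module PartnerE (b′ : ℕ) (b<w : suc b′ ≤ w) where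
    kᵢ : ℕ
    kᵢ = p + suc b′
    PE : List ℕ
    PE = kPartner n kᵢ GE

    kᵢ<length : kᵢ < length (partner GE)
    kᵢ<length = subst (kᵢ <_) (sym length-HE)
      (subst₂ _≤_ (solve 2 (λ a b′ → con 1 :+ a :+ (con 2 :+ b′) := con 1 :+ (con 1 :+ a :+ (con 1 :+ b′))) refl a b′)
                  (solve 2 (λ a M → con 1 :+ a :+ (con 1 :+ M) := a :+ ((con 1 :+ M) :+ con 1)) refl a M)
                  (+-monoʳ-≤ p (s≤s (≤-trans b<w (<⇒≤ w<M)))))

    Lcount-HE : Lcount n kᵢ (partner GE) ≡ N₁ C suc b′
    Lcount-HE = begin
      Lcount n kᵢ (partner GE)                        ≡⟨ cong (λ x → Lcount n x (partner GE)) (+-suc a (suc b′)) ⟨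
      Lcount n (a + suc (suc b′)) (partner GE)
        ≡⟨ Lcount-after-true-run (suc (suc b′)) (partner GE) _ HE-within HE-runs totalHE ⟩
      length rest C suc b′ + lexRank (suc (suc b′)) rest
      ≡⟨ cong₂ (λ x y → x C suc b′ + y) |rest|
               (lexRank-long-true-run (suc M) (suc (suc b′)) _ (s≤s (≤-<-trans b<w w<M))) ⟩
      N₁ C suc b′ + 0                                 ≡⟨ +-identityʳ _ ⟩
      N₁ C suc b′                                     ∎
      where
        open ≡-Reasoning
        rest : List Bool
        rest = expand ((true , suc M) ∷ (false , kk) ∷ (true , 1) ∷ [])
        |rest| : length rest ≡ N₁
        |rest| = trans (length-expand ((true , suc M) ∷ (false , kk) ∷ (true , 1) ∷ []))
                       (solve 2 (λ M kk → (con 1 :+ M) :+ (kk :+ (con 1 :+ con 0)) := con 2 :+ kk :+ M) refl M kk)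

    Lcount-PE : Lcount n kᵢ PE ≡ N₁ C suc b′
    Lcount-PE = begin
      Lcount n kᵢ PE ≡⟨ cong (Lcount n kᵢ) (kPartner-lexLast n kᵢ GE kᵢ<length) ⟩
      Lcount n kᵢ (lexLast (filterᵇ (λ K → lexᵇ K (partner GE)) (kSubsets n kᵢ)))
                     ≡⟨ Lcount-lexLast n kᵢ (partner GE) HE-within (subst (0 <_) (sym Lcount-HE) (C-pos N₁ (suc b′) b≤N₁)) ⟩
      Lcount n kᵢ (partner GE) ≡⟨ Lcount-HE ⟩
      N₁ C suc b′    ∎
      where
        open ≡-Reasoning
        b≤N₁ : suc b′ ≤ N₁
        b≤N₁ = ≤-trans b<w (≤-trans w≤M (m≤n+m M k))

  maxL-GF : maxL GF ≡ n
  maxL-GF = maxL-≡ GF n (λ y y∈ → ≤-pred (proj₂ (GF-within y y∈))) GF-n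

  runsHF : Runs
  runsHF = (true , p) ∷ (false , suc kk) ∷ (true , suc M) ∷ []

  HF-runs : RunsOf (χ (partner GF)) 1 runsHF
  HF-runs =
    (λ y 1≤y y< → trans (below y 1≤y (≤-<-trans (≤-pred y<) p<n)) (cong not (GF-below y (≤-pred y<)))) ,
    (λ y p<y y< → trans (below y (≤-trans (s≤s z≤n) p<y) (<-≤-trans y< p+suc-kk<n))
                        (cong not (GF-inside y p<y (≤-pred y<)))) ,
    top , tt
    where
      below : ∀ y → 1 ≤ y → y < n → memᵇ y (partner GF) ≡ not (memᵇ y GF)
      below y = partner-below GF n y maxL-GF
      top : ∀ y → suc (p + suc kk) ≤ y → y < suc (p + suc kk) + suc M → y ∈ᵇ partner GF
      top y <y y< with y Data.Nat.<? n
      ... | yes y<n = trans (below y (≤-trans (s≤s z≤n) <y) y<n) (cong not (GF-gap y <y y<n))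
      ... | no  y≮n = subst (_∈ᵇ partner GF) (≤-antisym (≮⇒≥ y≮n) (≤-pred (subst (y <_) end≡ y<)))
                        (partner-max GF n maxL-GF (≤-trans (s≤s z≤n) p<n))
        where end≡ : suc (p + suc kk) + suc M ≡ suc n
              end≡ = trans (+-suc (suc (p + suc kk)) M) (cong suc nF≡)

  totalHF : total runsHF ≡ n
  totalHF = solve 4 (λ a kk w j → (con 1 :+ a) :+ ((con 1 :+ kk) :+ ((con 1 :+ (w :+ j)) :+ con 0))
                               := con 1 :+ a :+ (con 2 :+ kk :+ (w :+ j))) refl a kk w j

  length-HF : length (partner GF) ≡ p + (suc M + 0)
  length-HF = length-partner GF n runsHF maxL-GF totalHF HF-runs

  HF-within : WithinSeg 1 n (partner GF)
  HF-within = WithinSeg-partner GF n n maxL-GF ≤-refl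

  module PartnerF (b′ : ℕ) (b<w : suc b′ ≤ w) where
    kᵢ : ℕ
    kᵢ = p + suc b′
    PF : List ℕ
    PF = kPartner n kᵢ GF

    b<M : suc b′ < M
    b<M = ≤-<-trans b<w w<M

    kᵢ<length : kᵢ < length (partner GF)
    kᵢ<length = subst (kᵢ <_) (sym length-HF)
      (subst (λ x → kᵢ < p + x) (sym (+-identityʳ (suc M))) (+-monoʳ-< p (s≤s (<⇒≤ b<M))))

    rest bs : List Bool
    rest = expand ((true , suc M) ∷ [])
    bs = replicate (suc kk) false ++ rest

    Lcount-HF≡ : Lcount n kᵢ (partner GF) ≡ lexRank (suc b′) bs
    Lcount-HF≡ = Lcount-after-true-run (suc b′) (partner GF) _ HF-within HF-runs totalHF

    Lcount-HF : Lcount n kᵢ (partner GF) + suc M C suc b′ ≡ N₁ C suc b′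
    Lcount-HF = begin
      Lcount n kᵢ (partner GF) + suc M C suc b′  ≡⟨ cong (_+ suc M C suc b′) Lcount-HF≡ ⟩
      lexRank (suc b′) bs + suc M C suc b′
        ≡⟨ lexRank-false-run (suc kk) (suc b′) rest (trans (length-expand ((true , suc M) ∷ [])) (+-identityʳ (suc M))) ⟩
      (suc kk + suc M) C suc b′ + lexRank (suc b′) rest
      ≡⟨ cong₂ (λ x y → x C suc b′ + y) (+-suc (suc kk) M) (lexRank-long-true-run (suc M) (suc b′) [] (s≤s (<⇒≤ b<M))) ⟩
      N₁ C suc b′ + 0                            ≡⟨ +-identityʳ _ ⟩
      N₁ C suc b′                                ∎
      where open ≡-Reasoning

    Lcount-PF : Lcount n kᵢ PF + suc M C suc b′ ≡ N₁ C suc b′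
    Lcount-PF = begin
      Lcount n kᵢ PF + suc M C suc b′
        ≡⟨ cong (λ H → Lcount n kᵢ H + suc M C suc b′) (kPartner-lexLast n kᵢ GF kᵢ<length) ⟩
      Lcount n kᵢ (lexLast (filterᵇ (λ K → lexᵇ K (partner GF)) (kSubsets n kᵢ))) + suc M C suc b′
      ≡⟨ cong (_+ suc M C suc b′) (Lcount-lexLast n kᵢ (partner GF) HF-within pos) ⟩
      Lcount n kᵢ (partner GF) + suc M C suc b′  ≡⟨ Lcount-HF ⟩
      N₁ C suc b′                                ∎
      where
        open ≡-Reasoning
        pos : 0 < Lcount n kᵢ (partner GF)
        pos = subst (0 <_) (sym Lcount-HF≡)
                (lexRank-false-head-pos b′ (replicate kk false ++ rest)
                   (subst (b′ ≤_) (sym (trans (length-expand ((false , kk) ∷ (true , suc M) ∷ []))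
                                              (cong (kk +_) (+-identityʳ (suc M)))))
                     (≤-trans (<⇒≤ (<-trans (n<1+n b′) b<M)) (≤-trans (n≤1+n M) (m≤n+m (suc M) kk)))))

  PartnerSizes : ℕ → (ℕ → ℕ) → Set
  PartnerSizes t kf = ∀ i → i ∈ range 3 t → Σ ℕ λ b′ → kf i ≡ p + suc b′ × suc b′ ≤ w

  module Partners (t : ℕ) (kf : ℕ → ℕ) where
    L : List ℕ
    L = range 3 t

    Σᵢ : (ℕ → ℕ) → ℕ
    Σᵢ f = sum (map f L)

    b : ℕ → ℕ
    b i = kf i ∸ p

    T-D T-E T-F P P⁻ S : ℕ → ℕ
    T-D i = Lcount n (kf i) (kPartner n (kf i) GD)
    T-E i = Lcount n (kf i) (kPartner n (kf i) GE)
    T-F i = Lcount n (kf i) (kPartner n (kf i) GF)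
    P  i = M C b i
    P⁻ i = M C (b i ∸ 1)
    S  i = N₁ C b i

    module _ (sizes : PartnerSizes t kf) where

      by-size : ∀ i → i ∈ L → (Q : ℕ → ℕ → Set) → (∀ b′ → suc b′ ≤ w → Q (p + suc b′) (suc b′)) → Q (kf i) (b i)
      by-size i i∈ Q Q-at with sizes i i∈
      ... | b′ , kfᵢ≡ , b<w rewrite kfᵢ≡ | m+n∸m≡n p (suc b′) = Q-at b′ b<w

      Σ-TD+P≡S : Σᵢ T-D + Σᵢ P ≡ Σᵢ S
      Σ-TD+P≡S = trans (sym (sum-map-+ T-D P L)) (sum-map-cong _ S L λ i i∈ →
        by-size i i∈ (λ kᵢ bᵢ → Lcount n kᵢ (kPartner n kᵢ GD) + M C bᵢ ≡ N₁ C bᵢ)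
                     (λ b′ b<w → PartnerD.Lcount-PD b′ (w ∸ suc b′) (sym (m+[n∸m]≡n b<w))))

      Σ-TE≡S : Σᵢ T-E ≡ Σᵢ S
      Σ-TE≡S = sum-map-cong T-E S L λ i i∈ →
        by-size i i∈ (λ kᵢ bᵢ → Lcount n kᵢ (kPartner n kᵢ GE) ≡ N₁ C bᵢ) PartnerE.Lcount-PE

      Σ-TF+P⁻+P≡S : Σᵢ T-F + (Σᵢ P⁻ + Σᵢ P) ≡ Σᵢ S
      Σ-TF+P⁻+P≡S = trans (cong (Σᵢ T-F +_) (sym (sum-map-+ P⁻ P L)))
        (trans (sym (sum-map-+ T-F (λ i → P⁻ i + P i) L)) (sum-map-cong _ S L λ i i∈ →
          by-size i i∈ (λ kᵢ bᵢ → Lcount n kᵢ (kPartner n kᵢ GF) + (M C (bᵢ ∸ 1) + M C bᵢ) ≡ N₁ C bᵢ)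
                       (λ b′ b<w → trans (cong (Lcount n (p + suc b′) (kPartner n (p + suc b′) GF) +_) (pascal M b′))
                                         (PartnerF.Lcount-PF b′ b<w))))

      Σ-ratio : suc j * Σᵢ P⁻ ≤ w * Σᵢ P
      Σ-ratio = subst₂ _≤_ (sum-map-*ˡ (suc j) P⁻ L) (sum-map-*ˡ w P L) (sum-map-mono _ _ L λ i i∈ →
        by-size i i∈ (λ _ bᵢ → suc j * (M C (bᵢ ∸ 1)) ≤ w * (M C bᵢ)) (C-ratio-bound {M} {w} {j} refl))

    module _ (kf1≡K : kf 1 ≡ K) (kf2≡k : kf 2 ≡ k) where

      -- Shifting every value of g by N₁ C K + N₁ C k lets all three be written without subtraction.
      shifted : ∀ G H T → Lcount n (kf 1) H + Lcount n (kf 2) G + T + (N₁ C K + N₁ C k)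
                        ≡ (Lcount n K H + N₁ C K) + (Lcount n k G + N₁ C k) + T
      shifted G H T rewrite kf1≡K | kf2≡k =
        solve 5 (λ l₁ l₂ T x y → l₁ :+ l₂ :+ T :+ (x :+ y)
                              := (l₁ :+ x) :+ (l₂ :+ y) :+ T) refl (Lcount n K H) (Lcount n k G) T (N₁ C K) (N₁ C k)

      g-GD : ∀ X → IsParity n k K GD X → g n t kf X GD + (N₁ C K + N₁ C k) ≡ (n C K + n C k) + M C j + 1 + Σᵢ T-D
      g-GD X X-parity = begin
        g n t kf X GD + (N₁ C K + N₁ C k)                           ≡⟨ shifted GD X (Σᵢ T-D) ⟩
        (Lcount n K X + N₁ C K) + (Lcount n k GD + N₁ C k) + Σᵢ T-D
          ≡⟨ cong₂ (λ u v → u + v + Σᵢ T-D) (Lcount-X X X-parity) Lcount-GD ⟩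
        (n C K + M C j) + (n C k + 1) + Σᵢ T-D
          ≡⟨ solve 4 (λ x y A T → (x :+ A) :+ (y :+ con 1) :+ T
                               := x :+ y :+ A :+ con 1 :+ T) refl (n C K) (n C k) (M C j) (Σᵢ T-D) ⟩
        (n C K + n C k) + M C j + 1 + Σᵢ T-D                        ∎
        where open ≡-Reasoning

      g-GE : ∀ Y → IsParity n k K GE Y → PartnerSizes t kf → g n t kf Y GE + (N₁ C K + N₁ C k) ≡ (n C K + n C k) + Σᵢ S
      g-GE Y Y-parity sizes = begin
        g n t kf Y GE + (N₁ C K + N₁ C k)                           ≡⟨ shifted GE Y (Σᵢ T-E) ⟩
        (Lcount n K Y + N₁ C K) + (Lcount n k GE + N₁ C k) + Σᵢ T-E
          ≡⟨ cong₂ _+_ (cong₂ _+_ (Lcount-Y Y Y-parity) Lcount-GE) (Σ-TE≡S sizes) ⟩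
        (n C K + n C k) + Σᵢ S                                      ∎
        where open ≡-Reasoning

      g-GF : ∀ Z → IsParity n k K GF Z →
        g n t kf Z GF + (N₁ C K + N₁ C k) ≡ (n C K + n C k) + (M C j + M C suc j) + suc M + Σᵢ T-F
      g-GF Z Z-parity = begin
        g n t kf Z GF + (N₁ C K + N₁ C k)                           ≡⟨ shifted GF Z (Σᵢ T-F) ⟩
        (Lcount n K Z + N₁ C K) + (Lcount n k GF + N₁ C k) + Σᵢ T-F
          ≡⟨ cong₂ (λ u v → u + v + Σᵢ T-F) (trans (Lcount-Z Z Z-parity) (cong (n C K +_) (sym (pascal M j)))) Lcount-GF ⟩
        (n C K + (M C j + M C suc j)) + (n C k + suc M) + Σᵢ T-F
          ≡⟨ solve 5 (λ x y AB m T → (x :+ AB) :+ (y :+ m) :+ T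
                                  := x :+ y :+ AB :+ m :+ T) refl (n C K) (n C k) (M C j + M C suc j) (suc M) (Σᵢ T-F) ⟩
        (n C K + n C k) + (M C j + M C suc j) + suc M + Σᵢ T-F      ∎
        where open ≡-Reasoning

  g-max-exceeds : ∀ t (kf : ℕ → ℕ) → kf 1 ≡ K → kf 2 ≡ k → PartnerSizes t kf →
    ∀ X Y Z → IsParity n k K GD X → IsParity n k K GE Y → IsParity n k K GF Z →
    g n t kf X GD < g n t kf Y GE ⊔ g n t kf Z GF
  g-max-exceeds t kf kf1≡K kf2≡k sizes X Y Z X-parity Y-parity Z-parity =
    max-exceeds {gD = g n t kf X GD} {gE = g n t kf Y GE} {gF = g n t kf Z GF}
                (g-GD kf1≡K kf2≡k X X-parity) (Σ-TD+P≡S sizes)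
                (g-GE kf1≡K kf2≡k Y Y-parity sizes)
                (g-GF kf1≡K kf2≡k Z Z-parity) (Σ-TF+P⁻+P≡S sizes)
                {w} {j} refl (s≤s z≤n) (C-ratio-top {M} {w} {j} refl) (Σ-ratio sizes)
    where open Partners t kf

MaxExceeds : ℕ → ℕ → (ℕ → ℕ) → ℕ → ℕ → ℕ → Set
MaxExceeds n t kf s k₂ k₁ = ∀ X Y Z
  → IsParity n k₂ k₁ (range s (s + k₂ ∸ 1)) X
  → IsParity n k₂ k₁ ((s ∸ 1) ∷ range (n ∸ k₂ + 2) n) Y
  → IsParity n k₂ k₁ (range s (s + k₂ ∸ 2) ++ (n ∷ [])) Z
  → g n t kf X (range s (s + k₂ ∸ 1))
    < g n t kf Y ((s ∸ 1) ∷ range (n ∸ k₂ + 2) n) ⊔ g n t kf Z (range s (s + k₂ ∸ 2) ++ (n ∷ []))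

max-exceeds-from : ∀ n t (kf : ℕ → ℕ) s → 3 ≤ t → 2 ≤ s →
  (∀ i → 3 ≤ i → i ≤ t → s ≤ kf i) → (∀ i → 3 ≤ i → i ≤ t → kf i ≤ kf 3) →
  kf 3 ≤ kf 2 → kf 2 < kf 1 → kf 1 + kf 3 ≤ n → MaxExceeds n t kf s (kf 2) (kf 1)
max-exceeds-from n t kf (suc zero)    _   (s≤s ())
max-exceeds-from n t kf (suc (suc a)) 3≤t _ s≤kfᵢ kfᵢ≤kf₃ kf₃≤kf₂ kf₂<kf₁ kf₁+kf₃≤n =
  subst₂ (MaxExceeds n t kf s) (sym kf₂≡) (sym kf₁≡) (at-n n n≡)
  where
    s : ℕ
    s = suc (suc a)
    s≤kf₃ : s ≤ kf 3
    s≤kf₃ = s≤kfᵢ 3 ≤-refl 3≤t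
    kk : ℕ
    kk = kf 2 ∸ 2
    kf₂≡ : kf 2 ≡ suc (suc kk)
    kf₂≡ = sym (m+[n∸m]≡n (≤-trans (s≤s (s≤s z≤n)) (≤-trans s≤kf₃ kf₃≤kf₂)))
    j′ K : ℕ
    j′ = kf 1 ∸ suc (kf 2)
    K = suc (suc kk) + suc j′
    kf₁≡ : kf 1 ≡ K
    kf₁≡ = trans (sym (m+[n∸m]≡n kf₂<kf₁)) (trans (sym (+-suc (kf 2) j′)) (cong (_+ suc j′) kf₂≡))
    p+K≤n : suc a + K ≤ n
    p+K≤n = ≤-trans (subst (_≤ K + kf 3) (+-comm K (suc a)) (+-monoʳ-≤ K (≤-trans (n≤1+n (suc a)) s≤kf₃)))
                    (subst (λ x → x + kf 3 ≤ n) kf₁≡ kf₁+kf₃≤n)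
    w : ℕ
    w = n ∸ (suc a + K)
    open Configuration a kk j′ w using (PartnerSizes; g-max-exceeds) renaming (n to nᶜ)
    n≡p+K+w : n ≡ suc a + K + w
    n≡p+K+w = sym (m+[n∸m]≡n p+K≤n)
    n≡ : n ≡ nᶜ
    n≡ = trans n≡p+K+w
      (solve 4 (λ a kk j′ w → con 1 :+ a :+ (con 2 :+ kk :+ (con 1 :+ j′)) :+ w
                           := con 1 :+ a :+ (con 2 :+ kk :+ (w :+ (con 1 :+ j′)))) refl a kk j′ w)
    sizes : PartnerSizes t kf
    sizes i i∈ with ∈ᵇ-range⁻ 3 t i (∈⇒∈ᵇ i (range 3 t) i∈)
    ... | 3≤i , i≤t = b′ , kfᵢ≡ , +-cancelˡ-≤ (suc a + K) (suc b′) w (subst₂ _≤_ lhs≡ n≡p+K+w K+kfᵢ≤n)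
      where
        b′ : ℕ
        b′ = kf i ∸ s
        kfᵢ≡ : kf i ≡ suc a + suc b′
        kfᵢ≡ = trans (sym (m+[n∸m]≡n (s≤kfᵢ i 3≤i i≤t))) (sym (+-suc (suc a) b′))
        K+kfᵢ≤n : K + kf i ≤ n
        K+kfᵢ≤n = ≤-trans (+-monoʳ-≤ K (kfᵢ≤kf₃ i 3≤i i≤t)) (subst (λ x → x + kf 3 ≤ n) kf₁≡ kf₁+kf₃≤n)
        lhs≡ : K + kf i ≡ suc a + K + suc b′
        lhs≡ = trans (cong (K +_) kfᵢ≡) (solve 3 (λ a K b → K :+ (con 1 :+ a :+ (con 1 :+ b))
                                                         := con 1 :+ a :+ K :+ (con 1 :+ b)) refl a K b′)
    at-n : ∀ m → m ≡ nᶜ → MaxExceeds m t kf s (suc (suc kk)) K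
    at-n .nᶜ refl = g-max-exceeds t kf kf₁≡ kf₂≡ sizes

antitone : ∀ (k : ℕ → ℕ) t → (∀ i → 2 ≤ i → i < t → k (suc i) ≤ k i) → ∀ {i j} → 2 ≤ i → i ≤ j → j ≤ t → k j ≤ k i
antitone k t step {i} 2≤i i≤j = go (≤⇒≤′ i≤j)
  where
    go : ∀ {j} → i ≤′ j → j ≤ t → k j ≤ k i
    go ≤′-refl               _     = ≤-refl
    go (≤′-step {j} i≤′j) j<t = ≤-trans (step j (≤-trans 2≤i (≤′⇒≤ i≤′j)) j<t) (go i≤′j (<⇒≤ j<t))

proposition3p20 : (n t : ℕ) (k : ℕ → ℕ) → 3 ≤ t → k 2 < k 1
    → (∀ i → 2 ≤ i → i < t → k (suc i) ≤ k i) → 2 ≤ k t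
    → k 1 + k 3 ≤ n → n < k 1 + k 2
    → (A₁ B₁ C₁ D₁ E₁ F₁ : List ℕ)
    → IsParity n (k 2) (k 1) (range 2 (k 2 + 1)) A₁
    → IsParity n (k 2) (k 1) (1 ∷ range (n ∸ k 2 + 2) n) B₁
    → IsParity n (k 2) (k 1) (range 2 (k 2) ++ (n ∷ [])) C₁
    → IsParity n (k 2) (k 1) (range (k t) (k t + k 2 ∸ 1)) D₁
    → IsParity n (k 2) (k 1) ((k t ∸ 1) ∷ range (n ∸ k 2 + 2) n) E₁
    → IsParity n (k 2) (k 1) (range (k t) (k t + k 2 ∸ 2) ++ (n ∷ [])) F₁
    → (g n t k A₁ (range 2 (k 2 + 1))
         < g n t k B₁ (1 ∷ range (n ∸ k 2 + 2) n)
           ⊔ g n t k C₁ (range 2 (k 2) ++ (n ∷ [])))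
      × (g n t k D₁ (range (k t) (k t + k 2 ∸ 1))
         < g n t k E₁ ((k t ∸ 1) ∷ range (n ∸ k 2 + 2) n)
           ⊔ g n t k F₁ (range (k t) (k t + k 2 ∸ 2) ++ (n ∷ [])))
proposition3p20 n t k 3≤t k₂<k₁ step 2≤kₜ k₁+k₃≤n _ A₁ B₁ C₁ D₁ E₁ F₁ A-par B-par C-par D-par E-par F-par =
  first-interval , last-interval
  where
    kᵢ≤k₃ : ∀ i → 3 ≤ i → i ≤ t → k i ≤ k 3
    kᵢ≤k₃ i 3≤i i≤t = antitone k t step (s≤s (s≤s z≤n)) 3≤i i≤t
    kₜ≤kᵢ : ∀ i → 3 ≤ i → i ≤ t → k t ≤ k i
    kₜ≤kᵢ i 3≤i i≤t = antitone k t step (≤-trans (n≤1+n 2) 3≤i) i≤t ≤-refl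
    k₃≤k₂ : k 3 ≤ k 2
    k₃≤k₂ = step 2 ≤-refl 3≤t
    max-exceeds-at : ∀ s → 2 ≤ s → (∀ i → 3 ≤ i → i ≤ t → s ≤ k i) → MaxExceeds n t k s (k 2) (k 1)
    max-exceeds-at s 2≤s s≤kᵢ = max-exceeds-from n t k s 3≤t 2≤s s≤kᵢ kᵢ≤k₃ k₃≤k₂ k₂<k₁ k₁+k₃≤n
    first-interval : g n t k A₁ (range 2 (k 2 + 1))
                     < g n t k B₁ (1 ∷ range (n ∸ k 2 + 2) n) ⊔ g n t k C₁ (range 2 (k 2) ++ (n ∷ []))
    first-interval =
      subst (λ u → IsParity n (k 2) (k 1) (range 2 u) A₁ → g n t k A₁ (range 2 u) < g-rest) (+-comm 1 (k 2))
            (λ A-par′ → max-exceeds-at 2 ≤-refl 2≤kᵢ A₁ B₁ C₁ A-par′ B-par C-par) A-par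
      where
        g-rest : ℕ
        g-rest = g n t k B₁ (1 ∷ range (n ∸ k 2 + 2) n) ⊔ g n t k C₁ (range 2 (k 2) ++ (n ∷ []))
        2≤kᵢ : ∀ i → 3 ≤ i → i ≤ t → 2 ≤ k i
        2≤kᵢ i 3≤i i≤t = ≤-trans 2≤kₜ (kₜ≤kᵢ i 3≤i i≤t)
    last-interval : g n t k D₁ (range (k t) (k t + k 2 ∸ 1))
                    < g n t k E₁ ((k t ∸ 1) ∷ range (n ∸ k 2 + 2) n) ⊔ g n t k F₁ (range (k t) (k t + k 2 ∸ 2) ++ (n ∷ []))
    last-interval = max-exceeds-at (k t) 2≤kₜ kₜ≤kᵢ D₁ E₁ F₁ D-par E-par F-par
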